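{- For even $n\ge 4$, the graph $\mathcal{H}_n$ has at least $C_{n/2}+n-3$ connected components.
   Context: Fix an integer $n\ge 2$ and place $2n$ points equidistantly on the unit circle. $\mathcal{M}_n$ is the set of all non-crossing straight-line perfect matchings on these $2n$ points (each has $n$ edges). For $M\in\mathcal{M}_n$, two edges $e,f\in M$ span an empty quadrilateral if the convex hull of $e$ and $f$ contains no other edge of $M$; replacing $e,f$ by the other two edges of this quadrilateral yields another matching of $\mathcal{M}_n$ (a flip). A flip is centered if the closed quadrilateral contains the center of the circle (possibly on its boundary). $\mathcal{H}_n$ is the graph with vertex set $\mathcal{M}_n$ and an edge between two matchings if they differ by a centered flip. $C_k=\frac{1}{k+1}\binom{2k}{k}$ is the $k$th Catalan number. -}

module Defs where

open import Data.Nat using (ℕ; suc; _+_; _*_; _∸_; _≤_; _<_)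
open import Data.Nat.DivMod using (_/_)
open import Data.Nat.Combinatorics using (_C_)
open import Data.Fin using (Fin; toℕ)
open import Data.Vec using (Vec; lookup; _[_]≔_)
open import Data.Product using (_×_; Σ; ∃; ∃-syntax)
open import Data.Sum using (_⊎_)
open import Relation.Nullary using (¬_)
open import Relation.Binary.PropositionalEquality using (_≡_; _≢_)
open import Relation.Binary.Construct.Closure.ReflexiveTransitive using (Star)

catalan : ℕ → ℕ
catalan k = ((2 * k) C k) / suc k

-- The 2n equidistant points on the unit circle, labelled 0,…,2n-1 in
-- counterclockwise order (point i at angle 2πi/(2n)).
Pt : ℕ → Set
Pt n = Fin (2 * n)

-- A perfect matching is encoded by its partner vector: entry i is the
-- point matched with i.
Partner : ℕ → Set
Partner n = Vec (Pt n) (2 * n)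

Between : ℕ → ℕ → ℕ → Set
Between a b x = (a < x × x < b) ⊎ (b < x × x < a)

-- chords {a,b} and {c,d} (points in convex position) cross iff exactly
-- one of c,d lies strictly on the arc between a and b.
Cross : ℕ → ℕ → ℕ → ℕ → Set
Cross a b c d = (Between a b c × ¬ Between a b d) ⊎ (¬ Between a b c × Between a b d)

IsNCMatching : (n : ℕ) → Partner n → Set
IsNCMatching n M =
  (∀ i → lookup M i ≢ i) ×
  (∀ i → lookup M (lookup M i) ≡ i) ×
  (∀ i j → ¬ Cross (toℕ i) (toℕ (lookup M i)) (toℕ j) (toℕ (lookup M j)))

SameArc : ℕ → ℕ → ℕ → ℕ → ℕ → ℕ → Set
SameArc a b c d x y =
  ((a < x × x < b) × (a < y × y < b)) ⊎
  ((b < x × x < c) × (b < y × y < c)) ⊎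
  ((c < x × x < d) × (c < y × y < d)) ⊎
  ((x < a ⊎ d < x) × (y < a ⊎ d < y))

-- The quadrilateral with vertices a<b<c<d is empty in M: no other edge
-- of M meets it, i.e. every edge not incident to a,b,c,d has both
-- endpoints on the same arc.
Empty : (n : ℕ) → Partner n → Pt n → Pt n → Pt n → Pt n → Set
Empty n M a b c d = ∀ x →
  toℕ x ≢ toℕ a → toℕ x ≢ toℕ b → toℕ x ≢ toℕ c → toℕ x ≢ toℕ d →
  SameArc (toℕ a) (toℕ b) (toℕ c) (toℕ d) (toℕ x) (toℕ (lookup M x))

-- The closed quadrilateral a<b<c<d contains the centre iff no gap
-- between consecutive vertices exceeds half the circle (n steps).
Centered : (n : ℕ) → Pt n → Pt n → Pt n → Pt n → Set
Centered n a b c d =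
  (toℕ b ∸ toℕ a ≤ n) × (toℕ c ∸ toℕ b ≤ n) × (toℕ d ∸ toℕ c ≤ n) ×
  (2 * n ∸ toℕ d + toℕ a ≤ n)

setPairs : (n : ℕ) → Partner n → Pt n → Pt n → Pt n → Pt n → Partner n
setPairs n M w x y z = (((M [ w ]≔ x) [ x ]≔ w) [ y ]≔ z) [ z ]≔ y

CFlip : (n : ℕ) → Partner n → Partner n → Set
CFlip n M M' = IsNCMatching n M × ∃[ a ] ∃[ b ] ∃[ c ] ∃[ d ]
  (toℕ a < toℕ b × toℕ b < toℕ c × toℕ c < toℕ d) ×
  Empty n M a b c d × Centered n a b c d ×
  ( (lookup M a ≡ b × lookup M c ≡ d × M' ≡ setPairs n M a d b c)
  ⊎ (lookup M a ≡ d × lookup M b ≡ c × M' ≡ setPairs n M a b c d))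

Connected : (n : ℕ) → Partner n → Partner n → Set
Connected n = Star (CFlip n)

-- Let n = 2k.  In an empty quadrilateral A < B < C < D of a non-crossing matching every
-- side encloses an arc whose points are matched among themselves, so all sides have odd
-- length; if the quadrilateral is centered, the sides are therefore shorter than n while the
-- diagonal AD is longer.  Weighting a chord {x < y} by (-1)^x when it is short and by
-- 3 (-1)^x when it is long, the total weight Φ is unchanged by centered flips.  Central
-- symmetry is preserved as well, and a symmetric matching only admits centered flips of
-- antipodal quadrilaterals, which keep every partner modulo n.  The C_k binary trees with k
-- nodes give symmetric matchings with distinct partners modulo n, and n - 3 asymmetric
-- matchings realise the distinct potentials n - 2, n - 4, ..., 6 - n.

module Submission where

module PartnerFunction where

  open import Defs
  open import Data.Nat
  open import Data.Fin using (Fin; toℕ; fromℕ<)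
  open import Data.Fin.Properties using (toℕ<n; fromℕ<-toℕ; toℕ-fromℕ<; toℕ-injective)
  open import Data.Vec using (lookup)
  open import Data.Product using (_,_)
  open import Data.Empty using (⊥-elim)
  open import Relation.Nullary using (¬_; yes; no)
  open import Relation.Binary.PropositionalEquality

  -- Reading the partner vector as a function on ℕ lets all order arguments
  -- happen in ℕ; the junk value 0 outside [0, 2n) is never inspected.
  partner : (n : ℕ) → Partner n → ℕ → ℕ
  partner n M i with i <? 2 * n
  ... | yes h = toℕ (lookup M (fromℕ< h))
  ... | no _ = 0

  partner-toℕ : ∀ n M (x : Fin (2 * n)) → partner n M (toℕ x) ≡ toℕ (lookup M x)
  partner-toℕ n M x with toℕ x <? 2 * n
  ... | yes h = cong (λ y → toℕ (lookup M y)) (fromℕ<-toℕ x h)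
  ... | no h = ⊥-elim (h (toℕ<n x))

  partner-fromℕ< : ∀ n M {i} (h : i < 2 * n) → toℕ (lookup M (fromℕ< h)) ≡ partner n M i
  partner-fromℕ< n M h = trans (sym (partner-toℕ n M (fromℕ< h))) (cong (partner n M) (toℕ-fromℕ< h))

  record NCInvolution (N : ℕ) (p : ℕ → ℕ) : Set where
    field
      bounded : ∀ i → i < N → p i < N
      involutive : ∀ i → i < N → p (p i) ≡ i
      fixpointFree : ∀ i → i < N → p i ≢ i
      nonCrossing : ∀ i j → i < N → j < N → ¬ Cross i (p i) j (p j)

  ncInvolution : ∀ n M → IsNCMatching n M → NCInvolution (2 * n) (partner n M)
  ncInvolution n M (fixpointFree , involutive , nonCrossing) = record
    { bounded = λ i h → subst (_< 2 * n) (partner-fromℕ< n M h) (toℕ<n _)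
    ; involutive = partner-involutive
    ; fixpointFree = λ i h e → fixpointFree (fromℕ< h) (toℕ-injective (trans (partner-fromℕ< n M h) (trans e (sym (toℕ-fromℕ< h)))))
    ; nonCrossing = partner-nonCrossing
    }
    where
    partner-involutive : ∀ i → i < 2 * n → partner n M (partner n M i) ≡ i
    partner-involutive i h = begin
        partner n M (partner n M i)
      ≡⟨ cong (partner n M) (sym (partner-fromℕ< n M h)) ⟩
        partner n M (toℕ (lookup M (fromℕ< h)))
      ≡⟨ partner-toℕ n M _ ⟩
        toℕ (lookup M (lookup M (fromℕ< h)))
      ≡⟨ cong toℕ (involutive (fromℕ< h)) ⟩
        toℕ (fromℕ< h)
      ≡⟨ toℕ-fromℕ< h ⟩
        i ∎
      where open ≡-Reasoning
    partner-nonCrossing : ∀ i j → i < 2 * n → j < 2 * n → ¬ Cross i (partner n M i) j (partner n M j)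
    partner-nonCrossing i j hi hj c = nonCrossing (fromℕ< hi) (fromℕ< hj)
       (subst₂ (λ u v → Cross u (toℕ (lookup M (fromℕ< hi))) v (toℕ (lookup M (fromℕ< hj)))) (sym (toℕ-fromℕ< hi)) (sym (toℕ-fromℕ< hj))
         (subst₂ (λ u v → Cross i u j v) (sym (partner-fromℕ< n M hi)) (sym (partner-fromℕ< n M hj)) c))


module ChordParity where

  open import Defs
  open PartnerFunction
  open import Data.Nat
  open import Data.Nat.Properties
  open import Data.Product using (_×_; _,_; proj₁; proj₂; ∃)
  open import Data.Sum using (inj₁; inj₂)
  open import Data.Empty using (⊥-elim)
  open import Relation.Nullary using (¬_; Dec; yes; no)
  open import Relation.Binary.Definitions using (tri<; tri≈; tri>)
  open import Relation.Binary.PropositionalEquality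
  open import Data.Nat.Tactic.RingSolver using (solve-∀)

  between? : ∀ a b x → Dec (Between a b x)
  between? a b x with a <? x | x <? b | b <? x | x <? a
  ... | yes p | yes q | _ | _ = yes (inj₁ (p , q))
  ... | _ | _ | yes p | yes q = yes (inj₂ (p , q))
  ... | no p | _ | no r | _ = no λ { (inj₁ (u , _)) → p u ; (inj₂ (u , _)) → r u }
  ... | no p | _ | _ | no s = no λ { (inj₁ (u , _)) → p u ; (inj₂ (_ , v)) → s v }
  ... | _ | no q | no r | _ = no λ { (inj₁ (_ , v)) → q v ; (inj₂ (u , _)) → r u }
  ... | _ | no q | _ | no s = no λ { (inj₁ (_ , v)) → q v ; (inj₂ (_ , v)) → s v }

  nonCrossing-between : ∀ {x y z w} → ¬ Cross x y z w → Between x y z → Between x y w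
  nonCrossing-between {x} {y} {z} {w} nc bz with between? x y w
  ... | yes b = b
  ... | no nb = ⊥-elim (nc (inj₁ (bz , nb)))

  between⇒< : ∀ {x y z} → x < y → Between x y z → x < z × z < y
  between⇒< x<y (inj₁ p) = p
  between⇒< x<y (inj₂ (y<z , z<x)) = ⊥-elim (<-asym x<y (<-trans y<z z<x))

  Closed : (ℕ → ℕ) → ℕ → ℕ → Set
  Closed p l u = ∀ x → l < x → x < u → l < p x × p x < u

  OddGap : ℕ → ℕ → Set
  OddGap l u = ∃ λ t → u ≡ l + suc (t + t)

  oddGap-join : ∀ {l m u} → OddGap (suc l) m → OddGap m u → OddGap l u
  oddGap-join {l} (s , refl) (t , refl) = s + t + 1 , arith l s t
    where
    arith : ∀ l s t → (suc l + suc (s + s)) + suc (t + t) ≡ l + suc ((s + t + 1) + (s + t + 1))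
    arith = solve-∀

  module _ {N p} (F : NCInvolution N p) where
    open NCInvolution F

    chord-closed : ∀ x → x < N → x < p x → Closed p x (p x)
    chord-closed x xN xy z xz zy =
      between⇒< xy (nonCrossing-between (nonCrossing x z xN (<-trans zy (bounded x xN))) (inj₁ (xz , zy)))

    first-chord : ∀ {l u} → suc l < u → u ≤ N → Closed p l u → suc l < p (suc l) × p (suc l) < u
    first-chord {l} lu uN cl = ≤∧≢⇒< (proj₁ cy) (≢-sym (fixpointFree (suc l) (<-≤-trans lu uN))) , proj₂ cy
      where cy = cl (suc l) ≤-refl lu

    -- The partner w of a point z right of the chord {x, y} cannot fall inside (x, y):
    -- that interval is closed, so z would be inside too.
    closed-right-of-chord : ∀ {l u} → suc l < u → u ≤ N → Closed p l u → Closed p (p (suc l)) u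
    closed-right-of-chord {l} {u} lu uN cl z yz zu = y<w , proj₂ cz
      where
      x = suc l
      y = p x
      xy : x < y
      xy = proj₁ (first-chord lu uN cl)
      cz : l < p z × p z < u
      cz = cl z (<-trans (<-trans ≤-refl xy) yz) zu
      w = p z
      pw≡z : p w ≡ z
      pw≡z = involutive z (<-≤-trans zu uN)
      w≢x : w ≢ x
      w≢x e = <-irrefl (trans (cong p (sym e)) pw≡z) yz
      w≢y : w ≢ y
      w≢y e = <-irrefl (trans (trans (sym (involutive x (<-≤-trans lu uN))) (cong p (sym e))) pw≡z) (<-trans xy yz)
      y<w : y < w
      y<w with <-cmp y w
      ... | tri< y<w _ _ = y<w
      ... | tri≈ _ y≡w _ = ⊥-elim (w≢y (sym y≡w))
      ... | tri> _ _ w<y = ⊥-elim (<-asym yz (subst (_< y) pw≡z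
                               (proj₂ (chord-closed x (<-≤-trans lu uN) xy w (≤∧≢⇒< (proj₁ cz) (≢-sym w≢x)) w<y))))

    closed⇒oddGapᶠ : ∀ fuel l u → u ≤ l + fuel → l < u → u ≤ N → Closed p l u → OddGap l u
    closed⇒oddGapᶠ zero l u uf lu uN cl = ⊥-elim (<-irrefl refl (≤-trans lu (subst (u ≤_) (+-identityʳ l) uf)))
    closed⇒oddGapᶠ (suc f) l u uf lu uN cl with m≤n⇒m<n∨m≡n lu
    ... | inj₂ l+1≡u = 0 , trans (sym l+1≡u) (+-comm 1 l)
    ... | inj₁ l+1<u = oddGap-join left right
      where
      y = p (suc l)
      xy : suc l < y
      xy = proj₁ (first-chord l+1<u uN cl)
      yu : y < u
      yu = proj₂ (first-chord l+1<u uN cl)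
      left : OddGap (suc l) y
      left = closed⇒oddGapᶠ f (suc l) y (≤-trans (≤-pred (≤-trans yu (≤-trans uf (≤-reflexive (+-suc l f))))) (n≤1+n (l + f)))
               xy (<⇒≤ (<-≤-trans yu uN)) (chord-closed (suc l) (<-≤-trans l+1<u uN) xy)
      right : OddGap y u
      right = closed⇒oddGapᶠ f y u (≤-trans uf (≤-trans (≤-reflexive (+-suc l f)) (+-monoˡ-≤ f (<⇒≤ xy))))
                yu uN (closed-right-of-chord l+1<u uN cl)

    closed⇒oddGap : ∀ {l u} → l < u → u ≤ N → Closed p l u → OddGap l u
    closed⇒oddGap {l} {u} = closed⇒oddGapᶠ u l u (m≤n+m u l)


module CenteredQuads where

  open import Defs
  open PartnerFunction
  open ChordParity
  open import Data.Nat
  open import Data.Nat.Properties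
  open import Data.Fin using (Fin; toℕ; fromℕ<)
  open import Data.Fin.Properties using (toℕ-fromℕ<; toℕ<n)
  open import Data.Product using (_×_; _,_)
  open import Data.Sum using (inj₁; inj₂)
  open import Data.Empty using (⊥-elim)
  open import Relation.Binary.PropositionalEquality
  open import Data.Nat.Tactic.RingSolver using (solve-∀)

  odd≢even : ∀ t k → suc (t + t) ≢ k + k
  odd≢even zero zero ()
  odd≢even zero (suc zero) ()
  odd≢even zero (suc (suc k)) ()
  odd≢even (suc t) zero ()
  odd≢even (suc t) (suc k) e = odd≢even t k (suc-injective (suc-injective (trans (cong (λ z → suc (suc z)) (sym (+-suc t t))) (trans e (cong suc (+-suc k k))))))

  oddGap⇒< : ∀ {l u} → OddGap l u → l < u
  oddGap⇒< {l} (t , refl) = m<m+n l z<s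

  oddGap-join₃ : ∀ {a b c d} → OddGap a b → OddGap b c → OddGap c d → OddGap a d
  oddGap-join₃ {a} (r , refl) (s , refl) (t , refl) = r + s + t + 1 , arith a r s t
    where
    arith : ∀ a r s t → ((a + suc (r + r)) + suc (s + s)) + suc (t + t) ≡ a + suc ((r + s + t + 1) + (r + s + t + 1))
    arith = solve-∀

  oddGap≤even⇒< : ∀ {A B} k → OddGap A B → B ∸ A ≤ k + k → B < A + (k + k)
  oddGap≤even⇒< {A} k (t , refl) h = +-monoʳ-< A (≤∧≢⇒< t+t<k+k (odd≢even t k))
    where
    t+t<k+k : suc (t + t) ≤ k + k
    t+t<k+k = subst (_≤ k + k) (m+n∸m≡n A (suc (t + t))) h

  wrapGap≤⇒ : ∀ {n A D} → D < 2 * n → 2 * n ∸ D + A ≤ n → A + n ≤ D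
  wrapGap≤⇒ {n} {A} {D} D<2n h = +-cancelˡ-≤ n (A + n) D (subst (_≤ n + D) (arith n A) 2n+A≤n+D)
    where
    arith : ∀ n A → 2 * n + A ≡ n + (A + n)
    arith = solve-∀
    2n+A≤n+D : 2 * n + A ≤ n + D
    2n+A≤n+D = subst (_≤ n + D)
      (trans (+-assoc (2 * n ∸ D) A D) (trans (cong ((2 * n ∸ D) +_) (+-comm A D))
        (trans (sym (+-assoc (2 * n ∸ D) D A)) (cong (_+ A) (m∸n+n≡m (<⇒≤ D<2n))))))
      (+-monoˡ-≤ D h)

  EmptyQuad : (n : ℕ) → (ℕ → ℕ) → ℕ → ℕ → ℕ → ℕ → Set
  EmptyQuad n p A B C D = ∀ x → x < 2 * n → x ≢ A → x ≢ B → x ≢ C → x ≢ D → SameArc A B C D x (p x)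

  emptyQuad : ∀ n M a b c d → Empty n M a b c d → EmptyQuad n (partner n M) (toℕ a) (toℕ b) (toℕ c) (toℕ d)
  emptyQuad n M a b c d e x xN h1 h2 h3 h4 =
    subst₂ (SameArc (toℕ a) (toℕ b) (toℕ c) (toℕ d)) (toℕ-fromℕ< xN) (partner-fromℕ< n M xN)
      (e (fromℕ< xN) (back h1) (back h2) (back h3) (back h4))
    where
    back : ∀ {y} → x ≢ y → toℕ (fromℕ< xN) ≢ y
    back h q = h (trans (sym (toℕ-fromℕ< xN)) q)

  module EmptyQuadSides {n p A B C D} (em : EmptyQuad n p A B C D) (ab : A < B) (bc : B < C) (cd : C < D) (dN : D < 2 * n) where
    closedAB : Closed p A B
    closedAB x ax xb with em x (<-trans xb (<-trans bc (<-trans cd dN))) (>⇒≢ ax) (<⇒≢ xb) (<⇒≢ (<-trans xb bc)) (<⇒≢ (<-trans xb (<-trans bc cd)))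
    ... | inj₁ (_ , q) = q
    ... | inj₂ (inj₁ ((bx , _) , _)) = ⊥-elim (<-asym xb bx)
    ... | inj₂ (inj₂ (inj₁ ((cx , _) , _))) = ⊥-elim (<-asym (<-trans xb bc) cx)
    ... | inj₂ (inj₂ (inj₂ (inj₁ xa , _))) = ⊥-elim (<-asym xa ax)
    ... | inj₂ (inj₂ (inj₂ (inj₂ dx , _))) = ⊥-elim (<-asym (<-trans xb (<-trans bc cd)) dx)
    closedBC : Closed p B C
    closedBC x bx xc with em x (<-trans xc (<-trans cd dN)) (>⇒≢ (<-trans ab bx)) (>⇒≢ bx) (<⇒≢ xc) (<⇒≢ (<-trans xc cd))
    ... | inj₁ ((_ , xb) , _) = ⊥-elim (<-asym xb bx)
    ... | inj₂ (inj₁ (_ , q)) = q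
    ... | inj₂ (inj₂ (inj₁ ((cx , _) , _))) = ⊥-elim (<-asym xc cx)
    ... | inj₂ (inj₂ (inj₂ (inj₁ xa , _))) = ⊥-elim (<-asym xa (<-trans ab bx))
    ... | inj₂ (inj₂ (inj₂ (inj₂ dx , _))) = ⊥-elim (<-asym (<-trans xc cd) dx)
    closedCD : Closed p C D
    closedCD x cx xd with em x (<-trans xd dN) (>⇒≢ (<-trans ab (<-trans bc cx))) (>⇒≢ (<-trans bc cx)) (>⇒≢ cx) (<⇒≢ xd)
    ... | inj₁ ((_ , xb) , _) = ⊥-elim (<-asym xb (<-trans bc cx))
    ... | inj₂ (inj₁ ((_ , xc) , _)) = ⊥-elim (<-asym xc cx)
    ... | inj₂ (inj₂ (inj₁ (_ , q))) = q
    ... | inj₂ (inj₂ (inj₂ (inj₁ xa , _))) = ⊥-elim (<-asym xa (<-trans ab (<-trans bc cx)))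
    ... | inj₂ (inj₂ (inj₂ (inj₂ dx , _))) = ⊥-elim (<-asym xd dx)

  record CenteredQuad (n A B C D : ℕ) : Set where
    field
      oddAB : OddGap A B
      oddBC : OddGap B C
      oddCD : OddGap C D
      B<A+n : B < A + n
      C<B+n : C < B + n
      D<C+n : D < C + n
      A+n<D : A + n < D
      D<2n : D < 2 * n

    A<B : A < B
    A<B = oddGap⇒< oddAB
    B<C : B < C
    B<C = oddGap⇒< oddBC
    C<D : C < D
    C<D = oddGap⇒< oddCD
    A<n : A < n
    A<n = +-cancelʳ-< n A n (<-trans A+n<D (subst (D <_) (cong (n +_) (+-identityʳ n)) D<2n))

  -- Each side of the quadrilateral encloses a closed arc, so all four sides are odd;
  -- being centered they are at most n, hence (n even) strictly less than n.
  centeredQuad : ∀ n k → n ≡ k + k → ∀ M → IsNCMatching n M → ∀ (a b c d : Fin (2 * n)) →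
        toℕ a < toℕ b × toℕ b < toℕ c × toℕ c < toℕ d →
        Empty n M a b c d → Centered n a b c d → CenteredQuad n (toℕ a) (toℕ b) (toℕ c) (toℕ d)
  centeredQuad n k refl M ism a b c d (ab , bc , cd) em (AB≤n , BC≤n , CD≤n , DA≤n) = record
    { oddAB = oddAB ; oddBC = oddBC ; oddCD = oddCD
    ; B<A+n = oddGap≤even⇒< k oddAB AB≤n
    ; C<B+n = oddGap≤even⇒< k oddBC BC≤n
    ; D<C+n = oddGap≤even⇒< k oddCD CD≤n
    ; A+n<D = ≤∧≢⇒< (wrapGap≤⇒ D<2n DA≤n) A+n≢D
    ; D<2n = D<2n
    }
    where
    A = toℕ a
    D = toℕ d
    F = ncInvolution n M ism
    D<2n : D < 2 * n
    D<2n = toℕ<n d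
    open EmptyQuadSides {n} (emptyQuad n M a b c d em) ab bc cd D<2n
    oddAB = closed⇒oddGap F ab (<⇒≤ (<-trans bc (<-trans cd D<2n))) closedAB
    oddBC = closed⇒oddGap F bc (<⇒≤ (<-trans cd D<2n)) closedBC
    oddCD = closed⇒oddGap F cd (<⇒≤ D<2n) closedCD
    A+n≢D : A + n ≢ D
    A+n≢D e with oddGap-join₃ oddAB oddBC oddCD
    ... | t , D≡ = odd≢even t k (+-cancelˡ-≡ A _ _ (trans (sym D≡) (sym e)))


module SetPairs where

  open import Defs
  open PartnerFunction
  open import Data.Nat using (ℕ; _*_; _<_)
  open import Data.Fin using (Fin; toℕ; fromℕ<)
  open import Data.Fin.Properties using (toℕ-fromℕ<)
  open import Data.Vec using (lookup; _[_]≔_)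
  open import Data.Vec.Properties using (lookup∘update; lookup∘update′)
  open import Relation.Binary.PropositionalEquality

  module SetPairsLookup (n : ℕ) (M : Partner n) (w x y z : Fin (2 * n))
     (w≢x : w ≢ x) (w≢y : w ≢ y) (w≢z : w ≢ z) (x≢y : x ≢ y) (x≢z : x ≢ z) (y≢z : y ≢ z) where
    V₁ = M [ w ]≔ x
    V₂ = V₁ [ x ]≔ w
    V₃ = V₂ [ y ]≔ z
    M' = setPairs n M w x y z

    V₁-x : lookup V₁ x ≡ lookup M x
    V₁-x = lookup∘update′ (≢-sym w≢x) M x
    V₂-y : lookup V₂ y ≡ lookup M y
    V₂-y = trans (lookup∘update′ (≢-sym x≢y) V₁ w) (lookup∘update′ (≢-sym w≢y) M x)
    V₃-z : lookup V₃ z ≡ lookup M z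
    V₃-z = trans (lookup∘update′ (≢-sym y≢z) V₂ z) (trans (lookup∘update′ (≢-sym x≢z) V₁ w) (lookup∘update′ (≢-sym w≢z) M x))

    at-z : lookup M' z ≡ y
    at-z = lookup∘update z V₃ y
    at-y : lookup M' y ≡ z
    at-y = trans (lookup∘update′ y≢z V₃ y) (lookup∘update y V₂ z)
    at-x : lookup M' x ≡ w
    at-x = trans (lookup∘update′ x≢z V₃ y) (trans (lookup∘update′ x≢y V₂ z) (lookup∘update x V₁ w))
    at-w : lookup M' w ≡ x
    at-w = trans (lookup∘update′ w≢z V₃ y) (trans (lookup∘update′ w≢y V₂ z) (trans (lookup∘update′ w≢x V₁ w) (lookup∘update w M x)))
    elsewhere : ∀ j → j ≢ w → j ≢ x → j ≢ y → j ≢ z → lookup M' j ≡ lookup M j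
    elsewhere j j≢w j≢x j≢y j≢z = trans (lookup∘update′ j≢z V₃ y) (trans (lookup∘update′ j≢y V₂ z)
                                    (trans (lookup∘update′ j≢x V₁ w) (lookup∘update′ j≢w M x)))

    partner-w : partner n M' (toℕ w) ≡ toℕ x
    partner-w = trans (partner-toℕ n M' w) (cong toℕ at-w)
    partner-x : partner n M' (toℕ x) ≡ toℕ w
    partner-x = trans (partner-toℕ n M' x) (cong toℕ at-x)
    partner-y : partner n M' (toℕ y) ≡ toℕ z
    partner-y = trans (partner-toℕ n M' y) (cong toℕ at-y)
    partner-z : partner n M' (toℕ z) ≡ toℕ y
    partner-z = trans (partner-toℕ n M' z) (cong toℕ at-z)
    partner-elsewhere : ∀ i → i < 2 * n → i ≢ toℕ w → i ≢ toℕ x → i ≢ toℕ y → i ≢ toℕ z →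
                        partner n M' i ≡ partner n M i
    partner-elsewhere i h i≢w i≢x i≢y i≢z =
      trans (sym (partner-fromℕ< n M' h))
        (trans (cong toℕ (elsewhere (fromℕ< h) (fin≢ i≢w) (fin≢ i≢x) (fin≢ i≢y) (fin≢ i≢z))) (partner-fromℕ< n M h))
      where
      fin≢ : ∀ {v} → i ≢ toℕ v → fromℕ< h ≢ v
      fin≢ q e = q (trans (sym (toℕ-fromℕ< h)) (cong toℕ e))


module Potential where

  open import Defs
  open ChordParity using (OddGap)
  open CenteredQuads
  open SetPairs
  open import Data.Nat as N using (ℕ; zero; suc; _<_; _<?_; _∸_)
  import Data.Nat.Properties as NP
  open import Data.Integer using (ℤ; +_; -_; _+_; _*_)
  open import Data.Integer.Properties using (neg-involutive; +-assoc; +-0-abelianGroup)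
  open import Algebra.Properties.AbelianGroup +-0-abelianGroup using (∙-cancelʳ)
  open import Data.Fin using (Fin; toℕ; zero; suc)
  import Data.Fin.Properties as Finₚ
  open import Data.Vec using (Vec; []; _∷_; lookup; _[_]≔_)
  open import Data.Product using (_,_; proj₁; proj₂)
  open import Data.Sum using (inj₁; inj₂)
  open import Data.Empty using (⊥-elim)
  open import Relation.Nullary using (¬_; yes; no)
  open import Relation.Binary.PropositionalEquality
  import Data.Integer.Tactic.RingSolver as ℤ-Solver

  sign : ℕ → ℤ
  sign zero = + 1
  sign (suc x) = - sign x

  sign-+even : ∀ x t → sign (x N.+ (t N.+ t)) ≡ sign x
  sign-+even x zero = cong sign (NP.+-identityʳ x)
  sign-+even x (suc t) = begin
      sign (x N.+ (suc t N.+ suc t))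
    ≡⟨ cong sign (arith x t) ⟩
      sign (suc (suc (x N.+ (t N.+ t))))
    ≡⟨ neg-involutive (sign (x N.+ (t N.+ t))) ⟩
      sign (x N.+ (t N.+ t))
    ≡⟨ sign-+even x t ⟩
      sign x ∎
    where
    open ≡-Reasoning
    arith : ∀ x t → x N.+ (suc t N.+ suc t) ≡ suc (suc (x N.+ (t N.+ t)))
    arith x t = trans (NP.+-suc x (t N.+ suc t)) (cong suc (trans (cong (x N.+_) (NP.+-suc t t)) (NP.+-suc x (t N.+ t))))

  sign-+odd : ∀ x t → sign (x N.+ suc (t N.+ t)) ≡ - sign x
  sign-+odd x t = trans (cong sign (NP.+-suc x (t N.+ t))) (cong -_ (sign-+even x t))

  sign-oddGap : ∀ {x y} → OddGap x y → sign y ≡ - sign x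
  sign-oddGap {x} (t , refl) = sign-+odd x t

  abstract
    -- kept abstract so that the ring solver treats weights as atoms
    chordWeight : ℕ → ℕ → ℕ → ℤ
    chordWeight n x y with x <? y
    ... | no _ = + 0
    ... | yes _ with y ∸ x <? n
    ... | yes _ = sign x
    ... | no _ = + 3 * sign x

    chordWeight-short : ∀ {n x y} → x < y → y ∸ x < n → chordWeight n x y ≡ sign x
    chordWeight-short {n} {x} {y} h1 h2 with x <? y
    ... | no q = ⊥-elim (q h1)
    ... | yes _ with y ∸ x <? n
    ... | yes _ = refl
    ... | no q = ⊥-elim (q h2)

    chordWeight-long : ∀ {n x y} → x < y → ¬ (y ∸ x < n) → chordWeight n x y ≡ + 3 * sign x
    chordWeight-long {n} {x} {y} h1 h2 with x <? y
    ... | no q = ⊥-elim (q h1)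
    ... | yes _ with y ∸ x <? n
    ... | yes q = ⊥-elim (h2 q)
    ... | no _ = refl

    chordWeight-back : ∀ {n x y} → y < x → chordWeight n x y ≡ + 0
    chordWeight-back {n} {x} {y} h with x <? y
    ... | no _ = refl
    ... | yes q = ⊥-elim (NP.<-asym h q)

  weightSum : ∀ {K} → (ℕ → ℕ → ℤ) → ℕ → ∀ {m} → Vec (Fin K) m → ℤ
  weightSum F off [] = + 0
  weightSum F off (v ∷ V) = F off (toℕ v) + weightSum F (suc off) V

  weightSum-update : ∀ {K} (F : ℕ → ℕ → ℤ) off {m} (V : Vec (Fin K) m) (w : Fin m) (y : Fin K) →
       weightSum F off (V [ w ]≔ y) + F (off N.+ toℕ w) (toℕ (lookup V w)) ≡ weightSum F off V + F (off N.+ toℕ w) (toℕ y)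
  weightSum-update F off (v ∷ V) zero y rewrite NP.+-identityʳ off =
    swap (F off (toℕ y)) (weightSum F (suc off) V) (F off (toℕ v))
    where
    swap : ∀ a b c → (a + b) + c ≡ (c + b) + a
    swap = ℤ-Solver.solve-∀
  weightSum-update F off (v ∷ V) (suc w) y = begin
      (F off (toℕ v) + weightSum F (suc off) (V [ w ]≔ y)) + F (off N.+ suc (toℕ w)) (toℕ (lookup V w))
    ≡⟨ cong (λ z → (F off (toℕ v) + weightSum F (suc off) (V [ w ]≔ y)) + F z (toℕ (lookup V w))) (NP.+-suc off (toℕ w)) ⟩
      (F off (toℕ v) + weightSum F (suc off) (V [ w ]≔ y)) + F (suc off N.+ toℕ w) (toℕ (lookup V w))
    ≡⟨ +-assoc (F off (toℕ v)) _ _ ⟩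
      F off (toℕ v) + (weightSum F (suc off) (V [ w ]≔ y) + F (suc off N.+ toℕ w) (toℕ (lookup V w)))
    ≡⟨ cong (λ t → F off (toℕ v) + t) (weightSum-update F (suc off) V w y) ⟩
      F off (toℕ v) + (weightSum F (suc off) V + F (suc off N.+ toℕ w) (toℕ y))
    ≡⟨ sym (+-assoc (F off (toℕ v)) _ _) ⟩
      (F off (toℕ v) + weightSum F (suc off) V) + F (suc off N.+ toℕ w) (toℕ y)
    ≡⟨ cong (λ z → (F off (toℕ v) + weightSum F (suc off) V) + F z (toℕ y)) (sym (NP.+-suc off (toℕ w))) ⟩
      (F off (toℕ v) + weightSum F (suc off) V) + F (off N.+ suc (toℕ w)) (toℕ y) ∎
    where open ≡-Reasoning

  isolate : ∀ {s p s' p' : ℤ} → s + p ≡ s' + p' → s ≡ s' + p' + - p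
  isolate {s} {p} e = trans (arith s p) (cong (_+ - p) e)
    where
    arith : ∀ s p → s ≡ (s + p) + - p
    arith = ℤ-Solver.solve-∀

  telescope₄ : ∀ {s₀ s₁ s₂ s₃ s₄ a b c d a' b' c' d' : ℤ} →
               s₁ + a ≡ s₀ + a' → s₂ + b ≡ s₁ + b' → s₃ + c ≡ s₂ + c' → s₄ + d ≡ s₃ + d' →
               s₄ + (a + b + c + d) ≡ s₀ + (a' + b' + c' + d')
  telescope₄ {s₀} {s₁} {s₂} {s₃} {s₄} {a} {b} {c} {d} {a'} {b'} {c'} {d'} e₁ e₂ e₃ e₄ = begin
      s₄ + (a + b + c + d)
    ≡⟨ cong (_+ (a + b + c + d)) s₄≡ ⟩
      (s₀ + a' + - a + b' + - b + c' + - c + d' + - d) + (a + b + c + d)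
    ≡⟨ arith s₀ a b c d a' b' c' d' ⟩
      s₀ + (a' + b' + c' + d') ∎
    where
    open ≡-Reasoning
    arith : ∀ s₀ a b c d a' b' c' d' →
            (s₀ + a' + - a + b' + - b + c' + - c + d' + - d) + (a + b + c + d) ≡ s₀ + (a' + b' + c' + d')
    arith = ℤ-Solver.solve-∀
    s₄≡ : s₄ ≡ s₀ + a' + - a + b' + - b + c' + - c + d' + - d
    s₄≡ = begin
        s₄
      ≡⟨ isolate {s₄} {d} {s₃} {d'} e₄ ⟩
        s₃ + d' + - d
      ≡⟨ cong (λ t → t + d' + - d) (isolate {s₃} {c} {s₂} {c'} e₃) ⟩
        s₂ + c' + - c + d' + - d
      ≡⟨ cong (λ t → t + c' + - c + d' + - d) (isolate {s₂} {b} {s₁} {b'} e₂) ⟩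
        s₁ + b' + - b + c' + - c + d' + - d
      ≡⟨ cong (λ t → t + b' + - b + c' + - c + d' + - d) (isolate {s₁} {a} {s₀} {a'} e₁) ⟩
        s₀ + a' + - a + b' + - b + c' + - c + d' + - d ∎

  module _ (F : ℕ → ℕ → ℤ) {n} (M : Partner n) (w x y z : Fin (2 N.* n))
           (w≢x : w ≢ x) (w≢y : w ≢ y) (w≢z : w ≢ z) (x≢y : x ≢ y) (x≢z : x ≢ z) (y≢z : y ≢ z) where
    open SetPairsLookup n M w x y z w≢x w≢y w≢z x≢y x≢z y≢z

    private
      W : Fin (2 N.* n) → Fin (2 N.* n) → ℤ
      W v u = F (toℕ v) (toℕ u)

      step : ∀ (V : Partner n) v u {t} → lookup V v ≡ t → weightSum F 0 (V [ v ]≔ u) + W v t ≡ weightSum F 0 V + W v u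
      step V v u refl = weightSum-update F 0 V v u

    weightSum-setPairs : ∀ {pw px py pz} → lookup M w ≡ pw → lookup M x ≡ px → lookup M y ≡ py → lookup M z ≡ pz →
      weightSum F 0 M' + (W w pw + W x px + W y py + W z pz) ≡ weightSum F 0 M + (W w x + W x w + W y z + W z y)
    weightSum-setPairs mw mx my mz =
      telescope₄ {weightSum F 0 M} {weightSum F 0 V₁} {weightSum F 0 V₂} {weightSum F 0 V₃} {weightSum F 0 M'}
        (step M w x mw) (step V₁ x w (trans V₁-x mx)) (step V₂ y z (trans V₂-y my)) (step V₃ z y (trans V₃-z mz))

  Φ : (n : ℕ) → Partner n → ℤ
  Φ n M = weightSum (chordWeight n) 0 M

  ∸<n : ∀ {C D n} → C N.≤ D → D < C N.+ n → D ∸ C < n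
  ∸<n {C} {D} {n} cd h = subst (D ∸ C <_) (NP.m+n∸m≡n C n) (NP.∸-monoˡ-< h cd)

  ¬∸<n : ∀ {A D n} → A N.+ n < D → ¬ (D ∸ A < n)
  ¬∸<n {A} {D} {n} h q = NP.<-asym h (subst (_< A N.+ n) (NP.m+[n∸m]≡n (NP.≤-trans (NP.m≤m+n A n) (NP.<⇒≤ h))) (NP.+-monoʳ-< A q))

  -- With s = sign A, the sides AB, BC, CD weigh s, -s, s and the long diagonal AD weighs 3s,
  -- so both ways of matching the quadrilateral along its boundary weigh 2s.
  module FlipPotential {n} (M : Partner n) (involutive : ∀ i → lookup M (lookup M i) ≡ i)
                       (a b c d : Fin (2 N.* n)) (G : CenteredQuad n (toℕ a) (toℕ b) (toℕ c) (toℕ d)) where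
    open CenteredQuad G

    W : Fin (2 N.* n) → Fin (2 N.* n) → ℤ
    W v u = chordWeight n (toℕ v) (toℕ u)

    s = sign (toℕ a)
    a<c : toℕ a < toℕ c
    a<c = NP.<-trans A<B B<C
    b<d : toℕ b < toℕ d
    b<d = NP.<-trans B<C C<D
    a<d : toℕ a < toℕ d
    a<d = NP.<-trans A<B b<d

    W-ab : W a b ≡ s
    W-ab = chordWeight-short A<B (∸<n (NP.<⇒≤ A<B) B<A+n)
    W-bc : W b c ≡ - s
    W-bc = trans (chordWeight-short B<C (∸<n (NP.<⇒≤ B<C) C<B+n)) (sign-oddGap oddAB)
    W-cd : W c d ≡ s
    W-cd = trans (chordWeight-short C<D (∸<n (NP.<⇒≤ C<D) D<C+n))
             (trans (sign-oddGap oddBC) (trans (cong -_ (sign-oddGap oddAB)) (neg-involutive s)))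
    W-ad : W a d ≡ + 3 * s
    W-ad = chordWeight-long a<d (¬∸<n A+n<D)

    partner-back : ∀ {v u} → lookup M v ≡ u → lookup M u ≡ v
    partner-back {v} e = trans (cong (lookup M) (sym e)) (involutive v)

    cancel : ∀ {M' : Partner n} {X Y} → Φ n M' + X ≡ Φ n M + Y → X ≡ Y → Φ n M ≡ Φ n M'
    cancel {M'} {X} e X≡Y = sym (∙-cancelʳ X (Φ n M') (Φ n M) (trans e (cong (λ t → Φ n M + t) (sym X≡Y))))

    Φ-flip-sides : lookup M a ≡ b → lookup M c ≡ d → Φ n M ≡ Φ n (setPairs n M a d b c)
    Φ-flip-sides ma mc =
      cancel {setPairs n M a d b c} (weightSum-setPairs (chordWeight n) {n} M a d b c (Finₚ.<⇒≢ a<d) (Finₚ.<⇒≢ A<B) (Finₚ.<⇒≢ a<c)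
                (≢-sym (Finₚ.<⇒≢ b<d)) (≢-sym (Finₚ.<⇒≢ C<D)) (Finₚ.<⇒≢ B<C)
                ma (partner-back mc) (partner-back ma) mc)
             balance
      where
      balance : W a b + W d c + W b a + W c d ≡ W a d + W d a + W b c + W c b
      balance rewrite W-ab | W-cd | W-ad | W-bc | chordWeight-back {n} A<B | chordWeight-back {n} C<D
                    | chordWeight-back {n} a<d | chordWeight-back {n} B<C = arith s
        where
        arith : ∀ s → s + + 0 + + 0 + s ≡ + 3 * s + + 0 + - s + + 0
        arith = ℤ-Solver.solve-∀

    Φ-flip-nested : lookup M a ≡ d → lookup M b ≡ c → Φ n M ≡ Φ n (setPairs n M a b c d)
    Φ-flip-nested ma mb =
      cancel {setPairs n M a b c d} (weightSum-setPairs (chordWeight n) {n} M a b c d (Finₚ.<⇒≢ A<B) (Finₚ.<⇒≢ a<c) (Finₚ.<⇒≢ a<d)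
                (Finₚ.<⇒≢ B<C) (Finₚ.<⇒≢ b<d) (Finₚ.<⇒≢ C<D)
                ma mb (partner-back mb) (partner-back ma))
             balance
      where
      balance : W a d + W b c + W c b + W d a ≡ W a b + W b a + W c d + W d c
      balance rewrite W-ab | W-cd | W-ad | W-bc | chordWeight-back {n} A<B | chordWeight-back {n} C<D
                    | chordWeight-back {n} a<d | chordWeight-back {n} B<C = arith s
        where
        arith : ∀ s → + 3 * s + - s + + 0 + + 0 ≡ s + + 0 + s + + 0
        arith = ℤ-Solver.solve-∀

  Φ-flip : ∀ n k → n ≡ k N.+ k → ∀ M M' → CFlip n M M' → Φ n M ≡ Φ n M'
  Φ-flip n k n≡k+k M M' (ism , a , b , c , d , a<b<c<d , em , cen , flip) with flip
  ... | inj₁ (ma , mc , refl) = FlipPotential.Φ-flip-sides M (proj₁ (proj₂ ism)) a b c d G ma mc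
    where G = centeredQuad n k n≡k+k M ism a b c d a<b<c<d em cen
  ... | inj₂ (ma , mb , refl) = FlipPotential.Φ-flip-nested M (proj₁ (proj₂ ism)) a b c d G ma mb
    where G = centeredQuad n k n≡k+k M ism a b c d a<b<c<d em cen


module Antipode where

  open import Defs
  open PartnerFunction
  open import Data.Nat
  open import Data.Nat.Properties
  open import Data.Fin using (Fin; toℕ; fromℕ<)
  open import Data.Fin.Properties using (toℕ<n; toℕ-fromℕ<; all?)
  open import Data.Vec using (Vec; map)
  open import Data.Sum using (inj₁; inj₂)
  open import Data.Empty using (⊥-elim)
  open import Relation.Nullary using (Dec; yes; no)
  open import Relation.Binary.PropositionalEquality

  antipode : ℕ → ℕ → ℕ
  antipode n x with x <? n
  ... | yes _ = x + n
  ... | no _ = x ∸ n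

  antipode-low : ∀ {n x} → x < n → antipode n x ≡ x + n
  antipode-low {n} {x} h with x <? n
  ... | yes _ = refl
  ... | no q = ⊥-elim (q h)

  antipode-high : ∀ {n x} → n ≤ x → antipode n x ≡ x ∸ n
  antipode-high {n} {x} h with x <? n
  ... | yes q = ⊥-elim (<-irrefl refl (<-≤-trans q h))
  ... | no _ = refl

  <+⇒∸< : ∀ {x A n} → n ≤ x → x < A + n → x ∸ n < A
  <+⇒∸< {x} {A} {n} nx h = +-cancelʳ-< n (x ∸ n) A (subst (_< A + n) (sym (m∸n+n≡m nx)) h)

  +<⇒<∸ : ∀ {x A n} → A + n < x → A < x ∸ n
  +<⇒<∸ {x} {A} {n} h = +-cancelʳ-< n A (x ∸ n) (subst (A + n <_) (sym (m∸n+n≡m (≤-trans (m≤n+m n A) (<⇒≤ h)))) h)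

  <n⇒+n<2n : ∀ {n x} → x < n → x + n < 2 * n
  <n⇒+n<2n {n} {x} lo = subst (x + n <_) (cong (n +_) (sym (+-identityʳ n))) (+-monoˡ-< n lo)

  antipode-involutive : ∀ n i → i < 2 * n → antipode n (antipode n i) ≡ i
  antipode-involutive n i h with <-≤-connex i n
  ... | inj₁ lo = trans (cong (antipode n) (antipode-low lo)) (trans (antipode-high (m≤n+m n i)) (m+n∸n≡m i n))
  ... | inj₂ hi = trans (cong (antipode n) (antipode-high hi)) (trans (antipode-low (<+⇒∸< hi i<n+n)) (m∸n+n≡m hi))
    where
    i<n+n : i < n + n
    i<n+n = subst (i <_) (cong (n +_) (+-identityʳ n)) h

  antipode< : ∀ n i → i < 2 * n → antipode n i < 2 * n
  antipode< n i h with <-≤-connex i n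
  ... | inj₁ lo = subst (_< 2 * n) (sym (antipode-low lo)) (<n⇒+n<2n lo)
  ... | inj₂ hi = subst (_< 2 * n) (sym (antipode-high hi)) (≤-<-trans (m∸n≤m i n) h)

  Symmetric : (n : ℕ) → Partner n → Set
  Symmetric n M = ∀ (x : Fin (2 * n)) → partner n M (antipode n (toℕ x)) ≡ antipode n (partner n M (toℕ x))

  symmetric? : ∀ n M → Dec (Symmetric n M)
  symmetric? n M = all? (λ x → partner n M (antipode n (toℕ x)) ≟ antipode n (partner n M (toℕ x)))

  SymmetricFun : ℕ → (ℕ → ℕ) → Set
  SymmetricFun n P = ∀ i → i < 2 * n → P (antipode n i) ≡ antipode n (P i)

  Symmetric⇒SymmetricFun : ∀ n M → Symmetric n M → SymmetricFun n (partner n M)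
  Symmetric⇒SymmetricFun n M e i h = subst (λ z → partner n M (antipode n z) ≡ antipode n (partner n M z)) (toℕ-fromℕ< h) (e (fromℕ< h))

  SymmetricFun⇒Symmetric : ∀ n M → SymmetricFun n (partner n M) → Symmetric n M
  SymmetricFun⇒Symmetric n M e x = e (toℕ x) (toℕ<n x)

  reduceMod : ℕ → ℕ → ℕ
  reduceMod n x with x <? n
  ... | yes _ = x
  ... | no _ = x ∸ n

  reduceMod-low : ∀ {n x} → x < n → reduceMod n x ≡ x
  reduceMod-low {n} {x} h with x <? n
  ... | yes _ = refl
  ... | no q = ⊥-elim (q h)

  reduceMod-high : ∀ {n x} → x < n → reduceMod n (x + n) ≡ x
  reduceMod-high {n} {x} h with x + n <? n
  ... | yes q = ⊥-elim (<-irrefl refl (<-≤-trans q (m≤n+m n x)))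
  ... | no _ = m+n∸n≡m x n

  reducedPartners : (n : ℕ) → Partner n → Vec ℕ (2 * n)
  reducedPartners n M = map (λ y → reduceMod n (toℕ y)) M


module AntipodalQuads where

  open import Defs
  open CenteredQuads
  open Antipode
  open import Data.Nat
  open import Data.Nat.Properties
  open import Data.Product using (_×_; _,_; proj₁)
  open import Data.Sum using (_⊎_; inj₁; inj₂)
  open import Data.Empty using (⊥; ⊥-elim)
  open import Relation.Nullary using (yes; no)
  open import Relation.Binary.Definitions using (tri<; tri≈; tri>)
  open import Relation.Binary.PropositionalEquality

  Outside : ℕ → ℕ → ℕ → ℕ → ℕ → Set
  Outside A B C D i = i ≢ A × i ≢ B × i ≢ C × i ≢ D

  Nested Sides : ℕ → ℕ → ℕ → ℕ → (ℕ → ℕ) → Set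
  Nested A B C D Q = Q A ≡ D × Q D ≡ A × Q B ≡ C × Q C ≡ B
  Sides A B C D Q = Q A ≡ B × Q B ≡ A × Q C ≡ D × Q D ≡ C

  outside⇒¬inside : ∀ {A D y} → y < A ⊎ D < y → A < y → y < D → ⊥
  outside⇒¬inside (inj₁ y<A) A<y _ = <-asym y<A A<y
  outside⇒¬inside (inj₂ D<y) _ y<D = <-asym y<D D<y

  outside⇒≢ : ∀ {A D v y} → A ≤ v → v ≤ D → y < A ⊎ D < y → y ≢ v
  outside⇒≢ A≤v _ (inj₁ y<A) = <⇒≢ (<-≤-trans y<A A≤v)
  outside⇒≢ _ v≤D (inj₂ D<y) = >⇒≢ (≤-<-trans v≤D D<y)

  SameArc-outside : ∀ {A B C D y z} → A < B → B < C → C < D → y < A ⊎ D < y → SameArc A B C D y z → z < A ⊎ D < z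
  SameArc-outside ab bc cd o (inj₁ ((ay , yb) , _)) = ⊥-elim (outside⇒¬inside o ay (<-trans yb (<-trans bc cd)))
  SameArc-outside ab bc cd o (inj₂ (inj₁ ((by , yc) , _))) = ⊥-elim (outside⇒¬inside o (<-trans ab by) (<-trans yc cd))
  SameArc-outside ab bc cd o (inj₂ (inj₂ (inj₁ ((cy , yd) , _)))) = ⊥-elim (outside⇒¬inside o (<-trans ab (<-trans bc cy)) yd)
  SameArc-outside ab bc cd o (inj₂ (inj₂ (inj₂ (_ , z-out)))) = z-out

  module _ {n P A B C D} (em : EmptyQuad n P A B C D) (A<B : A < B) (B<C : B < C) (C<D : C < D) (D<2n : D < 2 * n) where
    open EmptyQuadSides {n} em A<B B<C C<D D<2n

    partner-outside : ∀ {y} → y < 2 * n → y < A ⊎ D < y → P y < A ⊎ D < P y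
    partner-outside {y} y<2n o = SameArc-outside A<B B<C C<D o
      (em y y<2n (outside⇒≢ ≤-refl A≤D o) (outside⇒≢ (<⇒≤ A<B) (<⇒≤ B<D) o)
                 (outside⇒≢ (<⇒≤ (<-trans A<B B<C)) (<⇒≤ C<D) o) (outside⇒≢ A≤D ≤-refl o))
      where
      B<D : B < D
      B<D = <-trans B<C C<D
      A≤D : A ≤ D
      A≤D = <⇒≤ (<-trans A<B B<D)

    partner-middle : ∀ {y} → B < y → y < D → y ≢ C →
                     (y < C × B < P y × P y < C) ⊎ (C < y × C < P y × P y < D)
    partner-middle {y} B<y y<D y≢C with <-cmp y C
    ... | tri< y<C _ _ = inj₁ (y<C , closedBC y B<y y<C)
    ... | tri≈ _ y≡C _ = ⊥-elim (y≢C y≡C)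
    ... | tri> _ _ C<y = inj₂ (C<y , closedCD y C<y y<D)

  -- In a symmetric matching a flippable empty centered quadrilateral is antipodal: look at
  -- the antipode A + n of A, which lies between B and D, and at the chord through it.
  module AntipodalFlip {n P A B C D} (G : CenteredQuad n A B C D) (em : EmptyQuad n P A B C D)
                       (involutive : ∀ x → x < 2 * n → P (P x) ≡ x) (symmetric : SymmetricFun n P) where
    open CenteredQuad G
    open EmptyQuadSides {n} em A<B B<C C<D D<2n

    C<2n : C < 2 * n
    C<2n = <-trans C<D D<2n
    B<2n : B < 2 * n
    B<2n = <-trans B<C C<2n
    A<2n : A < 2 * n
    A<2n = <-trans A<B B<2n
    n≤D : n ≤ D
    n≤D = ≤-trans (m≤n+m n A) (<⇒≤ A+n<D)
    x = A + n

    partner-antipode : ∀ {y z} → y < 2 * n → P y ≡ z → P (antipode n y) ≡ antipode n z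
    partner-antipode y<2n e = trans (symmetric _ y<2n) (cong (antipode n) e)

    partner-x : ∀ {z} → P A ≡ z → P x ≡ antipode n z
    partner-x e = trans (cong P (sym (antipode-low A<n))) (partner-antipode A<2n e)

    antipode-C-outside : C < A + n → antipode n C < A ⊎ D < antipode n C
    antipode-C-outside C<A+n with <-≤-connex C n
    ... | inj₁ C<n = inj₂ (subst (D <_) (sym (antipode-low C<n)) D<C+n)
    ... | inj₂ n≤C = inj₁ (subst (_< A) (sym (antipode-high n≤C)) (<+⇒∸< n≤C C<A+n))

    partner-antipode-C : P C ≡ D → P (antipode n C) ≡ D ∸ n
    partner-antipode-C PC = trans (partner-antipode C<2n PC) (antipode-high n≤D)

    sides-inner : P C ≡ D → B + n < D → C < A + n → ⊥
    sides-inner PC B+n<D C<A+n with partner-outside {n} em A<B B<C C<D D<2n (antipode< n C C<2n) (antipode-C-outside C<A+n)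
    ... | inj₁ q = <-asym (subst (_< A) (partner-antipode-C PC) q) (<-trans A<B (+<⇒<∸ B+n<D))
    ... | inj₂ q = <-irrefl refl (<-≤-trans (subst (D <_) (partner-antipode-C PC) q) (m∸n≤m D n))

    B<partner-x : P C ≡ D → B < P x
    B<partner-x PC with x ≟ C
    ... | yes x≡C = subst (B <_) (sym (trans (cong P x≡C) PC)) (<-trans B<C C<D)
    ... | no x≢C with partner-middle {n} em A<B B<C C<D D<2n B<A+n A+n<D x≢C
    ...   | inj₁ (_ , B<Px , _) = B<Px
    ...   | inj₂ (_ , C<Px , _) = <-trans B<C C<Px

    sides-antipodal : P A ≡ B → P C ≡ D → C ≡ A + n × D ≡ B + n
    sides-antipodal PA PC with <-≤-connex B n
    ... | inj₂ n≤B = ⊥-elim (<-irrefl refl (<-≤-trans (B<partner-x PC)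
                       (≤-trans (≤-reflexive (trans (partner-x PA) (antipode-high n≤B))) (m∸n≤m B n))))
    ... | inj₁ B<n with x ≟ C | trans (partner-x PA) (antipode-low B<n)
    ...   | yes x≡C | Px≡B+n = sym x≡C , trans (sym PC) (trans (cong P (sym x≡C)) Px≡B+n)
    ...   | no x≢C | Px≡B+n with partner-middle {n} em A<B B<C C<D D<2n B<A+n A+n<D x≢C
    ...     | inj₁ (_ , _ , Px<C) = ⊥-elim (<-asym Px<C (subst (C <_) (sym Px≡B+n) C<B+n))
    ...     | inj₂ (C<x , _ , Px<D) = ⊥-elim (sides-inner PC (subst (_< D) Px≡B+n Px<D) C<x)

    module _ (PB : P B ≡ C) (A+n<C : A + n < C) where
      n≤C : n ≤ C
      n≤C = ≤-trans (m≤n+m n A) (<⇒≤ A+n<C)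
      partner-antipode-B : P (antipode n B) ≡ C ∸ n
      partner-antipode-B = trans (partner-antipode B<2n PB) (antipode-high n≤C)

      nested-inner-low : B < n → B < D ∸ n → ⊥
      nested-inner-low B<n B<D∸n =
        <-irrefl refl (<-≤-trans (subst (C <_) partner-antipode-B (proj₁ (closedCD y C<y y<D))) (m∸n≤m C n))
        where
        y = antipode n B
        C<y : C < y
        C<y = subst (C <_) (sym (antipode-low B<n)) C<B+n
        y<D : y < D
        y<D = subst (_< D) (sym (antipode-low B<n)) (subst (B + n <_) (m∸n+n≡m n≤D) (+-monoˡ-< n B<D∸n))

      nested-inner-high : n ≤ B → ⊥
      nested-inner-high n≤B with partner-outside {n} em A<B B<C C<D D<2n (antipode< n B B<2n)
                                   (inj₁ (subst (_< A) (sym (antipode-high n≤B)) (<+⇒∸< n≤B B<A+n)))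
      ... | inj₁ q = <-asym (subst (_< A) partner-antipode-B q) (+<⇒<∸ A+n<C)
      ... | inj₂ q = <-asym (subst (D <_) partner-antipode-B q) (≤-<-trans (m∸n≤m C n) C<D)

    nested-antipodal : P A ≡ D → P B ≡ C → C ≡ A + n × D ≡ B + n
    nested-antipodal PA PB with x ≟ C | trans (partner-x PA) (antipode-high n≤D)
    ... | yes x≡C | Px≡D∸n = sym x≡C , trans (sym (m∸n+n≡m n≤D)) (cong (_+ n) (trans (sym Px≡D∸n) (trans (cong P x≡C) PC)))
      where
      PC : P C ≡ B
      PC = trans (cong P (sym PB)) (involutive B B<2n)
    ... | no x≢C | Px≡D∸n with partner-middle {n} em A<B B<C C<D D<2n B<A+n A+n<D x≢C
    ...   | inj₂ (_ , C<Px , _) = ⊥-elim (<-asym C<Px (subst (_< C) (sym Px≡D∸n) (<+⇒∸< n≤D D<C+n)))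
    ...   | inj₁ (x<C , B<Px , _) with <-≤-connex B n
    ...     | inj₁ B<n = ⊥-elim (nested-inner-low PB x<C B<n (subst (B <_) Px≡D∸n B<Px))
    ...     | inj₂ n≤B = ⊥-elim (nested-inner-high PB x<C n≤B)

  module AntipodalQuad (n : ℕ) (A B C D : ℕ) (A<n : A < n) (B<n : B < n) (C≡A+n : C ≡ A + n) (D≡B+n : D ≡ B + n) where
    antipode-A : antipode n A ≡ C
    antipode-A = trans (antipode-low A<n) (sym C≡A+n)
    antipode-B : antipode n B ≡ D
    antipode-B = trans (antipode-low B<n) (sym D≡B+n)
    antipode-C : antipode n C ≡ A
    antipode-C = trans (cong (antipode n) C≡A+n) (trans (antipode-high (m≤n+m n A)) (m+n∸n≡m A n))
    antipode-D : antipode n D ≡ B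
    antipode-D = trans (cong (antipode n) D≡B+n) (trans (antipode-high (m≤n+m n B)) (m+n∸n≡m B n))

    symmetric-transfer : (Q Q' : ℕ → ℕ) → (∀ i → i < 2 * n → Outside A B C D i → Q i ≡ Q' i) →
               (∀ i → i < 2 * n → Q' (antipode n i) ≡ antipode n (Q' i)) → Nested A B C D Q ⊎ Sides A B C D Q →
               ∀ i → i < 2 * n → Q (antipode n i) ≡ antipode n (Q i)
    symmetric-transfer Q Q' agree symmetric' ty i h with i ≟ A | i ≟ B | i ≟ C | i ≟ D
    ... | yes refl | _ | _ | _ = caseA ty
      where
      caseA : Nested A B C D Q ⊎ Sides A B C D Q → Q (antipode n A) ≡ antipode n (Q A)
      caseA (inj₁ (qa , qd , qb , qc)) = trans (cong Q antipode-A) (trans qc (trans (sym antipode-D) (cong (antipode n) (sym qa))))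
      caseA (inj₂ (qa , qb , qc , qd)) = trans (cong Q antipode-A) (trans qc (trans (sym antipode-B) (cong (antipode n) (sym qa))))
    ... | no _ | yes refl | _ | _ = caseB ty
      where
      caseB : Nested A B C D Q ⊎ Sides A B C D Q → Q (antipode n B) ≡ antipode n (Q B)
      caseB (inj₁ (qa , qd , qb , qc)) = trans (cong Q antipode-B) (trans qd (trans (sym antipode-C) (cong (antipode n) (sym qb))))
      caseB (inj₂ (qa , qb , qc , qd)) = trans (cong Q antipode-B) (trans qd (trans (sym antipode-A) (cong (antipode n) (sym qb))))
    ... | no _ | no _ | yes refl | _ = caseC ty
      where
      caseC : Nested A B C D Q ⊎ Sides A B C D Q → Q (antipode n C) ≡ antipode n (Q C)
      caseC (inj₁ (qa , qd , qb , qc)) = trans (cong Q antipode-C) (trans qa (trans (sym antipode-B) (cong (antipode n) (sym qc))))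
      caseC (inj₂ (qa , qb , qc , qd)) = trans (cong Q antipode-C) (trans qa (trans (sym antipode-D) (cong (antipode n) (sym qc))))
    ... | no _ | no _ | no _ | yes refl = caseD ty
      where
      caseD : Nested A B C D Q ⊎ Sides A B C D Q → Q (antipode n D) ≡ antipode n (Q D)
      caseD (inj₁ (qa , qd , qb , qc)) = trans (cong Q antipode-D) (trans qb (trans (sym antipode-A) (cong (antipode n) (sym qd))))
      caseD (inj₂ (qa , qb , qc , qd)) = trans (cong Q antipode-D) (trans qb (trans (sym antipode-C) (cong (antipode n) (sym qd))))
    ... | no ia | no ib | no ic | no id = trans (agree (antipode n i) (antipode< n i h) antipode-outside) (trans (symmetric' i h) (cong (antipode n) (sym (agree i h (ia , ib , ic , id)))))
      where
      antipode-outside : Outside A B C D (antipode n i)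
      antipode-outside = (λ e → ic (trans (sym (antipode-involutive n i h)) (trans (cong (antipode n) e) antipode-A)))
         , (λ e → id (trans (sym (antipode-involutive n i h)) (trans (cong (antipode n) e) antipode-B)))
         , (λ e → ia (trans (sym (antipode-involutive n i h)) (trans (cong (antipode n) e) antipode-C)))
         , (λ e → ib (trans (sym (antipode-involutive n i h)) (trans (cong (antipode n) e) antipode-D)))

    reduce-A : reduceMod n A ≡ A
    reduce-A = reduceMod-low A<n
    reduce-B : reduceMod n B ≡ B
    reduce-B = reduceMod-low B<n
    reduce-C : reduceMod n C ≡ A
    reduce-C = trans (cong (reduceMod n) C≡A+n) (reduceMod-high A<n)
    reduce-D : reduceMod n D ≡ B
    reduce-D = trans (cong (reduceMod n) D≡B+n) (reduceMod-high B<n)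
    reduce-partner-A : ∀ Q → Nested A B C D Q ⊎ Sides A B C D Q → reduceMod n (Q A) ≡ B
    reduce-partner-A Q (inj₁ (qa , qd , qb , qc)) = trans (cong (reduceMod n) qa) reduce-D
    reduce-partner-A Q (inj₂ (qa , qb , qc , qd)) = trans (cong (reduceMod n) qa) reduce-B
    reduce-partner-B : ∀ Q → Nested A B C D Q ⊎ Sides A B C D Q → reduceMod n (Q B) ≡ A
    reduce-partner-B Q (inj₁ (qa , qd , qb , qc)) = trans (cong (reduceMod n) qb) reduce-C
    reduce-partner-B Q (inj₂ (qa , qb , qc , qd)) = trans (cong (reduceMod n) qb) reduce-A
    reduce-partner-C : ∀ Q → Nested A B C D Q ⊎ Sides A B C D Q → reduceMod n (Q C) ≡ B
    reduce-partner-C Q (inj₁ (qa , qd , qb , qc)) = trans (cong (reduceMod n) qc) reduce-B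
    reduce-partner-C Q (inj₂ (qa , qb , qc , qd)) = trans (cong (reduceMod n) qc) reduce-D
    reduce-partner-D : ∀ Q → Nested A B C D Q ⊎ Sides A B C D Q → reduceMod n (Q D) ≡ A
    reduce-partner-D Q (inj₁ (qa , qd , qb , qc)) = trans (cong (reduceMod n) qd) reduce-A
    reduce-partner-D Q (inj₂ (qa , qb , qc , qd)) = trans (cong (reduceMod n) qd) reduce-C

    reduceMod-agree : (Q Q' : ℕ → ℕ) → (∀ i → i < 2 * n → Outside A B C D i → Q i ≡ Q' i) →
             Nested A B C D Q ⊎ Sides A B C D Q → Nested A B C D Q' ⊎ Sides A B C D Q' → ∀ i → i < 2 * n → reduceMod n (Q i) ≡ reduceMod n (Q' i)
    reduceMod-agree Q Q' agree t t' i h with i ≟ A | i ≟ B | i ≟ C | i ≟ D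
    ... | yes refl | _ | _ | _ = trans (reduce-partner-A Q t) (sym (reduce-partner-A Q' t'))
    ... | no _ | yes refl | _ | _ = trans (reduce-partner-B Q t) (sym (reduce-partner-B Q' t'))
    ... | no _ | no _ | yes refl | _ = trans (reduce-partner-C Q t) (sym (reduce-partner-C Q' t'))
    ... | no _ | no _ | no _ | yes refl = trans (reduce-partner-D Q t) (sym (reduce-partner-D Q' t'))
    ... | no ia | no ib | no ic | no id = cong (reduceMod n) (agree i h (ia , ib , ic , id))


module SymmetryUnderFlips where

  open import Defs
  open PartnerFunction
  open CenteredQuads
  open Antipode
  open AntipodalQuads
  open import Data.Nat
  open import Data.Nat.Properties
  open import Data.Product using (_×_; _,_)
  open import Data.Sum using (_⊎_; inj₁; inj₂)
  open import Relation.Nullary using (yes; no)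
  open import Relation.Binary.PropositionalEquality

  quad-involutive : ∀ {A B C D Q} → Nested A B C D Q ⊎ Sides A B C D Q →
                    Q (Q A) ≡ A × Q (Q B) ≡ B × Q (Q C) ≡ C × Q (Q D) ≡ D
  quad-involutive {Q = Q} (inj₁ (qa , qd , qb , qc)) = trans (cong Q qa) qd , trans (cong Q qb) qc , trans (cong Q qc) qb , trans (cong Q qd) qa
  quad-involutive {Q = Q} (inj₂ (qa , qb , qc , qd)) = trans (cong Q qa) qb , trans (cong Q qb) qa , trans (cong Q qc) qd , trans (cong Q qd) qc

  module FlipSymmetry {n P P' A B C D} (G : CenteredQuad n A B C D) (F : NCInvolution (2 * n) P)
              (em : EmptyQuad n P A B C D) (agree : ∀ i → i < 2 * n → Outside A B C D i → P' i ≡ P i)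
              (typeP : Nested A B C D P ⊎ Sides A B C D P) (typeP' : Nested A B C D P' ⊎ Sides A B C D P') where
    open CenteredQuad G
    open NCInvolution F

    em' : EmptyQuad n P' A B C D
    em' x h xa xb xc xd = subst (SameArc A B C D x) (sym (agree x h (xa , xb , xc , xd))) (em x h xa xb xc xd)

    outside-preserved : ∀ i → i < 2 * n → Outside A B C D i → Outside A B C D (P i)
    outside-preserved i h (i≢A , i≢B , i≢C , i≢D) = ≢A typeP , ≢B typeP , ≢C typeP , ≢D typeP
      where
      back : ∀ {s} → P i ≡ s → i ≡ P s
      back e = trans (sym (involutive i h)) (cong P e)
      ≢A : Nested A B C D P ⊎ Sides A B C D P → P i ≢ A
      ≢A (inj₁ (pa , _ , _ , _)) e = i≢D (trans (back e) pa)
      ≢A (inj₂ (pa , _ , _ , _)) e = i≢B (trans (back e) pa)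
      ≢B : Nested A B C D P ⊎ Sides A B C D P → P i ≢ B
      ≢B (inj₁ (_ , _ , pb , _)) e = i≢C (trans (back e) pb)
      ≢B (inj₂ (_ , pb , _ , _)) e = i≢A (trans (back e) pb)
      ≢C : Nested A B C D P ⊎ Sides A B C D P → P i ≢ C
      ≢C (inj₁ (_ , _ , _ , pc)) e = i≢B (trans (back e) pc)
      ≢C (inj₂ (_ , _ , pc , _)) e = i≢D (trans (back e) pc)
      ≢D : Nested A B C D P ⊎ Sides A B C D P → P i ≢ D
      ≢D (inj₁ (_ , pd , _ , _)) e = i≢A (trans (back e) pd)
      ≢D (inj₂ (_ , _ , _ , pd)) e = i≢C (trans (back e) pd)

    involutive' : ∀ i → i < 2 * n → P' (P' i) ≡ i
    involutive' i h with i ≟ A | i ≟ B | i ≟ C | i ≟ D | quad-involutive typeP'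
    ... | yes refl | _ | _ | _ | (qqA , _ , _ , _) = qqA
    ... | no _ | yes refl | _ | _ | (_ , qqB , _ , _) = qqB
    ... | no _ | no _ | yes refl | _ | (_ , _ , qqC , _) = qqC
    ... | no _ | no _ | no _ | yes refl | (_ , _ , _ , qqD) = qqD
    ... | no i≢A | no i≢B | no i≢C | no i≢D | _ =
      trans (cong P' (agree i h out)) (trans (agree (P i) (bounded i h) (outside-preserved i h out)) (involutive i h))
      where out = (i≢A , i≢B , i≢C , i≢D)

    symmetric⇒antipodal : ∀ {Q} → EmptyQuad n Q A B C D → (∀ x → x < 2 * n → Q (Q x) ≡ x) → SymmetricFun n Q →
                          Nested A B C D Q ⊎ Sides A B C D Q → C ≡ A + n × D ≡ B + n
    symmetric⇒antipodal emQ invQ symQ (inj₁ (qa , _ , qb , _)) = AntipodalFlip.nested-antipodal G emQ invQ symQ qa qb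
    symmetric⇒antipodal emQ invQ symQ (inj₂ (qa , _ , qc , _)) = AntipodalFlip.sides-antipodal G emQ invQ symQ qa qc

    B<n : D ≡ B + n → B < n
    B<n e = +-cancelʳ-< n B n (subst (_< n + n) e (subst (D <_) (cong (n +_) (+-identityʳ n)) D<2n))

    agree' : ∀ i → i < 2 * n → Outside A B C D i → P i ≡ P' i
    agree' i h o = sym (agree i h o)

    symmetric⇒symmetric' : SymmetricFun n P → SymmetricFun n P'
    symmetric⇒symmetric' sym with symmetric⇒antipodal em involutive sym typeP
    ... | (C≡ , D≡) = AntipodalQuad.symmetric-transfer n A B C D A<n (B<n D≡) C≡ D≡ P' P agree sym typeP'

    symmetric'⇒symmetric : SymmetricFun n P' → SymmetricFun n P
    symmetric'⇒symmetric sym with symmetric⇒antipodal em' involutive' sym typeP'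
    ... | (C≡ , D≡) = AntipodalQuad.symmetric-transfer n A B C D A<n (B<n D≡) C≡ D≡ P P' agree' sym typeP

    reduceMod-preserved : SymmetricFun n P → ∀ i → i < 2 * n → reduceMod n (P i) ≡ reduceMod n (P' i)
    reduceMod-preserved sym with symmetric⇒antipodal em involutive sym typeP
    ... | (C≡ , D≡) = AntipodalQuad.reduceMod-agree n A B C D A<n (B<n D≡) C≡ D≡ P P' agree' typeP typeP'


module ComponentInvariant where

  open import Defs
  open PartnerFunction
  open CenteredQuads
  open SetPairs
  open Potential
  open Antipode
  open AntipodalQuads
  open SymmetryUnderFlips
  open import Data.Nat
  open import Data.Nat.Properties using (<-trans)
  open import Data.Integer using (ℤ)
  open import Data.Fin using (Fin; toℕ)
  open import Data.Fin.Properties using (toℕ<n)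
  import Data.Fin.Properties as Finₚ
  open import Data.Vec using (Vec; lookup)
  open import Data.Vec.Properties using (lookup-map; tabulate∘lookup; tabulate-cong)
  open import Data.Product using (_×_; _,_)
  open import Data.Sum using (_⊎_; inj₁; inj₂)
  open import Data.Empty using (⊥-elim)
  open import Relation.Nullary using (¬_; yes; no)
  open import Relation.Binary.PropositionalEquality
  open import Relation.Binary.Construct.Closure.ReflexiveTransitive using (fold)

  invariant : (n : ℕ) → Partner n → Vec ℕ (2 * n) ⊎ ℤ
  invariant n M with symmetric? n M
  ... | yes _ = inj₁ (reducedPartners n M)
  ... | no _ = inj₂ (Φ n M)

  invariant-symmetric : ∀ n M → Symmetric n M → invariant n M ≡ inj₁ (reducedPartners n M)
  invariant-symmetric n M sym with symmetric? n M
  ... | yes _ = refl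
  ... | no asym = ⊥-elim (asym sym)

  invariant-asymmetric : ∀ n M → ¬ Symmetric n M → invariant n M ≡ inj₂ (Φ n M)
  invariant-asymmetric n M asym with symmetric? n M
  ... | yes sym = ⊥-elim (asym sym)
  ... | no _ = refl

  reducedPartners-cong : ∀ n M M' → (∀ i → i < 2 * n → reduceMod n (partner n M i) ≡ reduceMod n (partner n M' i)) →
                         reducedPartners n M ≡ reducedPartners n M'
  reducedPartners-cong n M M' h =
    trans (sym (tabulate∘lookup _)) (trans (tabulate-cong pointwise) (tabulate∘lookup _))
    where
    pointwise : ∀ j → lookup (reducedPartners n M) j ≡ lookup (reducedPartners n M') j
    pointwise j = trans (lookup-map j _ M) (trans (cong (reduceMod n) (sym (partner-toℕ n M j)))
                    (trans (h (toℕ j) (toℕ<n j)) (trans (cong (reduceMod n) (partner-toℕ n M' j)) (sym (lookup-map j _ M')))))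

  record FlipPreserves (n : ℕ) (M M' : Partner n) : Set where
    field
      symmetric-forth : Symmetric n M → Symmetric n M'
      symmetric-back : Symmetric n M' → Symmetric n M
      reduced : Symmetric n M → reducedPartners n M ≡ reducedPartners n M'
      potential : Φ n M ≡ Φ n M'

  module _ {n k} (n≡k+k : n ≡ k + k) {M} (ism : IsNCMatching n M) {a b c d : Fin (2 * n)}
           (ord : toℕ a < toℕ b × toℕ b < toℕ c × toℕ c < toℕ d)
           (em : Empty n M a b c d) (cen : Centered n a b c d) where
    private
      A = toℕ a
      B = toℕ b
      C = toℕ c
      D = toℕ d
      P = partner n M
      G = centeredQuad n k n≡k+k M ism a b c d ord em cen
      F = ncInvolution n M ism
      open CenteredQuad G

      partner-lookup : ∀ {x y : Fin (2 * n)} → lookup M x ≡ y → P (toℕ x) ≡ toℕ y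
      partner-lookup e = trans (partner-toℕ n M _) (cong toℕ e)

      partner-back : ∀ {x y} → x < 2 * n → P x ≡ y → P y ≡ x
      partner-back h e = trans (cong P (sym e)) (NCInvolution.involutive F _ h)

      preserves : ∀ {M'} → CFlip n M M' → (∀ i → i < 2 * n → Outside A B C D i → partner n M' i ≡ P i) →
                  Nested A B C D P ⊎ Sides A B C D P → Nested A B C D (partner n M') ⊎ Sides A B C D (partner n M') →
                  FlipPreserves n M M'
      preserves {M'} flip agree typeP typeP' = record
        { symmetric-forth = λ sym → SymmetricFun⇒Symmetric n M' (symmetric⇒symmetric' (Symmetric⇒SymmetricFun n M sym))
        ; symmetric-back = λ sym → SymmetricFun⇒Symmetric n M (symmetric'⇒symmetric (Symmetric⇒SymmetricFun n M' sym))
        ; reduced = λ sym → reducedPartners-cong n M M' (reduceMod-preserved (Symmetric⇒SymmetricFun n M sym))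
        ; potential = Φ-flip n k n≡k+k M M' flip
        }
        where open FlipSymmetry G F (emptyQuad n M a b c d em) agree typeP typeP'

    sides-flipPreserves : ∀ (ma : lookup M a ≡ b) (mc : lookup M c ≡ d) → FlipPreserves n M (setPairs n M a d b c)
    sides-flipPreserves ma mc =
      preserves (ism , a , b , c , d , ord , em , cen , inj₁ (ma , mc , refl))
        (λ i h (i≢A , i≢B , i≢C , i≢D) → partner-elsewhere i h i≢A i≢D i≢B i≢C)
        (inj₂ (partner-lookup ma , partner-back (toℕ<n a) (partner-lookup ma) , partner-lookup mc , partner-back (toℕ<n c) (partner-lookup mc)))
        (inj₁ (partner-w , partner-x , partner-y , partner-z))
      where
      open SetPairsLookup n M a d b c (Finₚ.<⇒≢ (<-trans A<B (<-trans B<C C<D))) (Finₚ.<⇒≢ A<B) (Finₚ.<⇒≢ (<-trans A<B B<C))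
                                     (≢-sym (Finₚ.<⇒≢ (<-trans B<C C<D))) (≢-sym (Finₚ.<⇒≢ C<D)) (Finₚ.<⇒≢ B<C)

    nested-flipPreserves : ∀ (ma : lookup M a ≡ d) (mb : lookup M b ≡ c) → FlipPreserves n M (setPairs n M a b c d)
    nested-flipPreserves ma mb =
      preserves (ism , a , b , c , d , ord , em , cen , inj₂ (ma , mb , refl))
        (λ i h (i≢A , i≢B , i≢C , i≢D) → partner-elsewhere i h i≢A i≢B i≢C i≢D)
        (inj₁ (partner-lookup ma , partner-back (toℕ<n a) (partner-lookup ma) , partner-lookup mb , partner-back (toℕ<n b) (partner-lookup mb)))
        (inj₂ (partner-w , partner-x , partner-y , partner-z))
      where
      open SetPairsLookup n M a b c d (Finₚ.<⇒≢ A<B) (Finₚ.<⇒≢ (<-trans A<B B<C)) (Finₚ.<⇒≢ (<-trans A<B (<-trans B<C C<D)))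
                                     (Finₚ.<⇒≢ B<C) (Finₚ.<⇒≢ (<-trans B<C C<D)) (Finₚ.<⇒≢ C<D)

  flipPreserves : ∀ n k → n ≡ k + k → ∀ M M' → CFlip n M M' → FlipPreserves n M M'
  flipPreserves n k n≡k+k M _ (ism , a , b , c , d , ord , em , cen , inj₁ (ma , mc , refl)) =
    sides-flipPreserves {k = k} n≡k+k ism ord em cen ma mc
  flipPreserves n k n≡k+k M _ (ism , a , b , c , d , ord , em , cen , inj₂ (ma , mb , refl)) =
    nested-flipPreserves {k = k} n≡k+k ism ord em cen ma mb

  invariant-flip : ∀ n k → n ≡ k + k → ∀ M M' → CFlip n M M' → invariant n M ≡ invariant n M'
  invariant-flip n k n≡k+k M M' flip with symmetric? n M | symmetric? n M' | flipPreserves n k n≡k+k M M' flip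
  ... | yes sym | yes _ | pres = cong inj₁ (FlipPreserves.reduced pres sym)
  ... | yes sym | no asym' | pres = ⊥-elim (asym' (FlipPreserves.symmetric-forth pres sym))
  ... | no asym | yes sym' | pres = ⊥-elim (asym (FlipPreserves.symmetric-back pres sym'))
  ... | no _ | no _ | pres = cong inj₂ (FlipPreserves.potential pres)

  invariant-connected : ∀ n k → n ≡ k + k → ∀ {M M'} → Connected n M M' → invariant n M ≡ invariant n M'
  invariant-connected n k n≡k+k =
    fold (λ M M' → invariant n M ≡ invariant n M') (λ flip eq → trans (invariant-flip n k n≡k+k _ _ flip) eq) refl

  invariant-injective⇒disconnected : ∀ n k → n ≡ k + k → ∀ {m} (R : Fin m → Partner n) →
    (∀ i j → invariant n (R i) ≡ invariant n (R j) → i ≡ j) → ∀ i j → i ≢ j → ¬ Connected n (R i) (R j)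
  invariant-injective⇒disconnected n k n≡k+k R injective i j i≢j c = i≢j (injective i j (invariant-connected n k n≡k+k c))


module Tabulation where

  open import Defs
  open PartnerFunction
  open Potential
  open import Data.Nat as N using (ℕ; zero; suc; _<_)
  import Data.Nat.Properties as NP
  open import Data.Integer using (ℤ; +_; _+_)
  import Data.Integer.Properties as ZP
  open import Data.Fin using (Fin; toℕ; fromℕ<)
  open import Data.Fin.Properties using (toℕ<n; toℕ-fromℕ<; toℕ-injective)
  open import Data.Vec using (Vec; lookup; tabulate; _∷_; [])
  open import Data.Vec.Properties using (lookup∘tabulate)
  open import Data.Product
  open import Relation.Nullary
  open import Relation.Binary.PropositionalEquality

  rangeSum : (ℕ → ℤ) → ℕ → ℕ → ℤ
  rangeSum G a zero = + 0
  rangeSum G a (suc m) = G a + rangeSum G (suc a) m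

  rangeSum-split : ∀ G a m m' → rangeSum G a (m N.+ m') ≡ rangeSum G a m + rangeSum G (a N.+ m) m'
  rangeSum-split G a zero m' = trans (cong (λ z → rangeSum G z m') (sym (NP.+-identityʳ a))) (sym (ZP.+-identityˡ _))
  rangeSum-split G a (suc m) m' = trans (cong (λ z → G a + z) (trans (rangeSum-split G (suc a) m m') (cong (λ z → rangeSum G (suc a) m + rangeSum G z m') (sym (NP.+-suc a m))))) (sym (ZP.+-assoc (G a) _ _))

  weightSum-rangeSum : ∀ {K} (F : ℕ → ℕ → ℤ) off {m} (V : Vec (Fin K) m) (g : ℕ → ℕ) →
       (∀ (x : Fin m) → toℕ (lookup V x) ≡ g (off N.+ toℕ x)) → weightSum F off V ≡ rangeSum (λ i → F i (g i)) off m
  weightSum-rangeSum F off [] g h = refl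
  weightSum-rangeSum F off (v ∷ V) g h = cong₂ _+_ (cong (F off) (trans (h Fin.zero) (cong g (NP.+-identityʳ off))))
     (weightSum-rangeSum F (suc off) V g (λ x → trans (h (Fin.suc x)) (cong g (NP.+-suc off (toℕ x)))))
    where import Data.Fin as Fin

  fromFunction : (n : ℕ) (f : ℕ → ℕ) → (∀ i → i < 2 N.* n → f i < 2 N.* n) → Partner n
  fromFunction n f hb = tabulate (λ x → fromℕ< (hb (toℕ x) (toℕ<n x)))

  fromFunction-lookup : ∀ n f hb (x : Fin (2 N.* n)) → toℕ (lookup (fromFunction n f hb) x) ≡ f (toℕ x)
  fromFunction-lookup n f hb x = trans (cong toℕ (lookup∘tabulate _ x)) (toℕ-fromℕ< _)

  fromFunction-partner : ∀ n f hb i → i < 2 N.* n → partner n (fromFunction n f hb) i ≡ f i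
  fromFunction-partner n f hb i h = trans (sym (partner-fromℕ< n _ h)) (trans (fromFunction-lookup n f hb (fromℕ< h)) (cong f (toℕ-fromℕ< h)))

  fromFunction-isNCMatching : ∀ n f hb → (∀ i → i < 2 N.* n → f i ≢ i) → (∀ i → i < 2 N.* n → f (f i) ≡ i) →
           (∀ i j → i < 2 N.* n → j < 2 N.* n → ¬ Cross i (f i) j (f j)) → IsNCMatching n (fromFunction n f hb)
  fromFunction-isNCMatching n f hb nf iv nonCrossing = (λ x e → nf (toℕ x) (toℕ<n x) (trans (sym (fromFunction-lookup n f hb x)) (cong toℕ e)))
    , (λ x → toℕ-injective (trans (fromFunction-lookup n f hb _) (trans (cong f (fromFunction-lookup n f hb x)) (iv (toℕ x) (toℕ<n x)))))
    , (λ x y c → nonCrossing (toℕ x) (toℕ y) (toℕ<n x) (toℕ<n y) (subst₂ (λ u v → Cross (toℕ x) u (toℕ y) v) (fromFunction-lookup n f hb x) (fromFunction-lookup n f hb y) c))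

  Φ-fromFunction : ∀ n f hb → Φ n (fromFunction n f hb) ≡ rangeSum (λ i → chordWeight n i (f i)) 0 (2 N.* n)
  Φ-fromFunction n f hb = weightSum-rangeSum (chordWeight n) 0 (fromFunction n f hb) f (fromFunction-lookup n f hb)


module TreeMatchings where

  open import Data.Nat
  open import Data.Nat.Properties
  open import Data.Empty
  open import Relation.Nullary
  open import Relation.Binary.PropositionalEquality
  open import Data.Nat.Tactic.RingSolver

  data Tree : Set where
    leaf : Tree
    node : Tree → Tree → Tree

  size : Tree → ℕ
  size leaf = 0
  size (node l r) = suc (size l + size r)

  double : ℕ → ℕ
  double x = x + x

  -- The non-crossing matching of 2 · size t points encoded by t: the root matches 0 with
  -- 2 · size l + 1, the left subtree is matched in between and the right one after.
  treeMatch : Tree → ℕ → ℕ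
  treeMatch leaf x = x
  treeMatch (node l r) zero = suc (double (size l))
  treeMatch (node l r) (suc x) with x <? double (size l)
  ... | yes _ = suc (treeMatch l x)
  ... | no _ with x ≟ double (size l)
  ...   | yes _ = 0
  ...   | no _ = suc (suc (double (size l) + treeMatch r (x ∸ suc (double (size l)))))

  module _ (l r : Tree) where
    private
      L = size l
    treeMatch-left : ∀ {x} → x < double L → treeMatch (node l r) (suc x) ≡ suc (treeMatch l x)
    treeMatch-left {x} h with x <? double L
    ... | yes _ = refl
    ... | no q = ⊥-elim (q h)
    treeMatch-mid : treeMatch (node l r) (suc (double L)) ≡ 0
    treeMatch-mid with double L <? double L
    ... | yes q = ⊥-elim (<-irrefl refl q)
    ... | no _ with double L ≟ double L
    ...   | yes _ = refl
    ...   | no q = ⊥-elim (q refl)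
    treeMatch-right : ∀ y → treeMatch (node l r) (suc (suc (double L + y))) ≡ suc (suc (double L + treeMatch r y))
    treeMatch-right y with suc (double L + y) <? double L
    ... | yes q = ⊥-elim (<-irrefl refl (≤-<-trans (m≤m+n (double L) y) (<-trans (n<1+n _) q)))
    ... | no _ with suc (double L + y) ≟ double L
    ...   | yes q = ⊥-elim (<-irrefl (sym q) (s≤s (m≤m+n (double L) y)))
    ...   | no _ = cong (λ z → suc (suc (double L + treeMatch r z))) (m+n∸m≡n (suc (double L)) y)

  double-node : ∀ a b → double (suc (a + b)) ≡ suc (suc (double a + double b))
  double-node = arith
    where
    arith : ∀ a b → suc (a + b) + suc (a + b) ≡ suc (suc ((a + a) + (b + b)))
    arith = solve-∀

  data TreeView (L R : ℕ) : ℕ → Set where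
    at-root : TreeView L R 0
    in-left : ∀ y → y < double L → TreeView L R (suc y)
    at-mid : TreeView L R (suc (double L))
    in-right : ∀ y → y < double R → TreeView L R (suc (suc (double L + y)))

  treeView : ∀ L R x → x < suc (suc (double L + double R)) → TreeView L R x
  treeView L R zero h = at-root
  treeView L R (suc y) h with y <? double L
  ... | yes q = in-left y q
  ... | no q with y ≟ double L
  ...   | yes refl = at-mid
  ...   | no q' = subst (TreeView L R) (cong suc e) (in-right y' bounded)
    where
    gt : double L < y
    gt = ≤∧≢⇒< (≮⇒≥ q) (λ e → q' (sym e))
    y' = y ∸ suc (double L)
    e : suc (double L + y') ≡ y
    e = m+[n∸m]≡n gt
    bounded : y' < double R
    bounded = +-cancelˡ-< (suc (double L)) y' (double R) (subst (_< suc (double L) + double R) (sym e) (≤-pred h))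

  record TreeInvolution (t : Tree) : Set where
    field
      bounded : ∀ x → x < double (size t) → treeMatch t x < double (size t)
      fixpointFree : ∀ x → x < double (size t) → treeMatch t x ≢ x
      involutive : ∀ x → x < double (size t) → treeMatch t (treeMatch t x) ≡ x

  treeInvolution : ∀ t → TreeInvolution t
  treeInvolution leaf = record { bounded = λ x () ; fixpointFree = λ x () ; involutive = λ x () }
  treeInvolution (node l r) = record { bounded = b ; fixpointFree = nf ; involutive = iv }
    where
    L = size l
    R = size r
    Tl = treeInvolution l
    Tr = treeInvolution r
    N' = suc (suc (double L + double R))
    eN : double (size (node l r)) ≡ N'
    eN = double-node L R
    b' : ∀ x → TreeView L R x → treeMatch (node l r) x < N'
    b' .0 at-root = s≤s (s≤s (m≤m+n (double L) (double R)))
    b' .(suc y) (in-left y h) = subst (_< N') (sym (treeMatch-left l r h)) (s≤s (s≤s (≤-trans (<⇒≤ (TreeInvolution.bounded Tl y h)) (m≤m+n (double L) (double R)))))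
    b' .(suc (double L)) at-mid = subst (_< N') (sym (treeMatch-mid l r)) z<s
    b' .(suc (suc (double L + y))) (in-right y h) = subst (_< N') (sym (treeMatch-right l r y)) (s≤s (s≤s (+-monoʳ-< (double L) (TreeInvolution.bounded Tr y h))))
    b : ∀ x → x < double (size (node l r)) → treeMatch (node l r) x < double (size (node l r))
    b x h = subst (treeMatch (node l r) x <_) (sym eN) (b' x (treeView L R x (subst (x <_) eN h)))
    nf' : ∀ x → TreeView L R x → treeMatch (node l r) x ≢ x
    nf' .0 at-root ()
    nf' .(suc y) (in-left y h) e = TreeInvolution.fixpointFree Tl y h (suc-injective (trans (sym (treeMatch-left l r h)) e))
    nf' .(suc (double L)) at-mid e = 0≢1+n (trans (sym (treeMatch-mid l r)) e)
    nf' .(suc (suc (double L + y))) (in-right y h) e = TreeInvolution.fixpointFree Tr y h (+-cancelˡ-≡ (double L) _ _ (suc-injective (suc-injective (trans (sym (treeMatch-right l r y)) e))))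
    nf : ∀ x → x < double (size (node l r)) → treeMatch (node l r) x ≢ x
    nf x h = nf' x (treeView L R x (subst (x <_) eN h))
    iv' : ∀ x → TreeView L R x → treeMatch (node l r) (treeMatch (node l r) x) ≡ x
    iv' .0 at-root = treeMatch-mid l r
    iv' .(suc y) (in-left y h) = trans (cong (treeMatch (node l r)) (treeMatch-left l r h)) (trans (treeMatch-left l r (TreeInvolution.bounded Tl y h)) (cong suc (TreeInvolution.involutive Tl y h)))
    iv' .(suc (double L)) at-mid = cong (treeMatch (node l r)) (treeMatch-mid l r)
    iv' .(suc (suc (double L + y))) (in-right y h) = trans (cong (treeMatch (node l r)) (treeMatch-right l r y)) (trans (treeMatch-right l r (treeMatch r y)) (cong (λ z → suc (suc (double L + z))) (TreeInvolution.involutive Tr y h)))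
    iv : ∀ x → x < double (size (node l r)) → treeMatch (node l r) (treeMatch (node l r) x) ≡ x
    iv x h = iv' x (treeView L R x (subst (x <_) eN h))


module TreeNonCrossing where

  open import Defs
  open TreeMatchings
  open import Data.Nat
  open import Data.Nat.Properties
  open import Data.Product
  open import Data.Sum
  open import Relation.Nullary
  open import Relation.Binary.PropositionalEquality

  ¬between-below : ∀ {a b c} → c < a → c < b → ¬ Between a b c
  ¬between-below ca cb (inj₁ (ac , _)) = <-asym ca ac
  ¬between-below ca cb (inj₂ (bc , _)) = <-asym cb bc

  ¬between-above : ∀ {a b c} → a < c → b < c → ¬ Between a b c
  ¬between-above ac bc (inj₁ (_ , cb)) = <-asym bc cb
  ¬between-above ac bc (inj₂ (_ , ca)) = <-asym ac ca

  ¬between-left : ∀ {a b} → ¬ Between a b a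
  ¬between-left (inj₁ (p , _)) = <-irrefl refl p
  ¬between-left (inj₂ (_ , p)) = <-irrefl refl p

  ¬between-right : ∀ {a b} → ¬ Between a b b
  ¬between-right (inj₁ (_ , p)) = <-irrefl refl p
  ¬between-right (inj₂ (p , _)) = <-irrefl refl p

  ¬cross-outside : ∀ {a b c d} → ¬ Between a b c → ¬ Between a b d → ¬ Cross a b c d
  ¬cross-outside p q (inj₁ (bc , _)) = p bc
  ¬cross-outside p q (inj₂ (_ , bd)) = q bd

  ¬cross-inside : ∀ {a b c d} → Between a b c → Between a b d → ¬ Cross a b c d
  ¬cross-inside bc bd (inj₁ (_ , q)) = q bd
  ¬cross-inside bc bd (inj₂ (p , _)) = p bc

  between-swap : ∀ {a b c} → Between a b c → Between b a c
  between-swap (inj₁ p) = inj₂ p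
  between-swap (inj₂ p) = inj₁ p

  cross-swap : ∀ {a b c d} → Cross a b c d → Cross b a c d
  cross-swap (inj₁ (p , q)) = inj₁ (between-swap p , λ z → q (between-swap z))
  cross-swap (inj₂ (p , q)) = inj₂ ((λ z → p (between-swap z)) , between-swap q)

  between-+⁻ : ∀ k {a b c} → Between (k + a) (k + b) (k + c) → Between a b c
  between-+⁻ k (inj₁ (p , q)) = inj₁ (+-cancelˡ-< k _ _ p , +-cancelˡ-< k _ _ q)
  between-+⁻ k (inj₂ (p , q)) = inj₂ (+-cancelˡ-< k _ _ p , +-cancelˡ-< k _ _ q)

  between-+ : ∀ k {a b c} → Between a b c → Between (k + a) (k + b) (k + c)
  between-+ k (inj₁ (p , q)) = inj₁ (+-monoʳ-< k p , +-monoʳ-< k q)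
  between-+ k (inj₂ (p , q)) = inj₂ (+-monoʳ-< k p , +-monoʳ-< k q)

  cross-+⁻ : ∀ k {a b c d} → Cross (k + a) (k + b) (k + c) (k + d) → Cross a b c d
  cross-+⁻ k (inj₁ (p , q)) = inj₁ (between-+⁻ k p , λ z → q (between-+ k z))
  cross-+⁻ k (inj₂ (p , q)) = inj₂ ((λ z → p (between-+ k z)) , between-+⁻ k q)

  treeMatch-nonCrossing : ∀ t x y → x < double (size t) → y < double (size t) → ¬ Cross x (treeMatch t x) y (treeMatch t y)
  treeMatch-nonCrossing leaf x y () _
  treeMatch-nonCrossing (node l r) x y hx hy = go x y (treeView L R x (subst (x <_) eN hx)) (treeView L R y (subst (y <_) eN hy))
    where
    L = size l
    R = size r
    S = suc (double L)
    eN : double (size (node l r)) ≡ suc (suc (double L + double R))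
    eN = double-node L R
    Tl = treeInvolution l
    Tr = treeInvolution r
    t = node l r
    chord-side : ∀ y → TreeView L R y → (y ≤ S × treeMatch t y ≤ S) ⊎ (∃ λ y' → y ≡ suc (suc (double L + y')) × treeMatch t y ≡ suc (suc (double L + treeMatch r y')) × y' < double R)
    chord-side .0 at-root = inj₁ (z≤n , ≤-refl)
    chord-side .(suc y') (in-left y' h) = inj₁ (s≤s (<⇒≤ (<-≤-trans h ≤-refl)) , subst (_≤ S) (sym (treeMatch-left l r h)) (s≤s (<⇒≤ (TreeInvolution.bounded Tl y' h))))
    chord-side .S at-mid = inj₁ (≤-refl , subst (_≤ S) (sym (treeMatch-mid l r)) z≤n)
    chord-side .(suc (suc (double L + y'))) (in-right y' h) = inj₂ (y' , refl , treeMatch-right l r y' , h)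
    root-chord-nonCrossing : ∀ y → TreeView L R y → ¬ Cross 0 S y (treeMatch t y)
    root-chord-nonCrossing .0 at-root = ¬cross-outside ¬between-left ¬between-right
    root-chord-nonCrossing .(suc y') (in-left y' h) = subst (λ z → ¬ Cross 0 S (suc y') z) (sym (treeMatch-left l r h))
       (¬cross-inside (inj₁ (z<s , s≤s h)) (inj₁ (z<s , s≤s (TreeInvolution.bounded Tl y' h))))
    root-chord-nonCrossing .S at-mid = subst (λ z → ¬ Cross 0 S S z) (sym (treeMatch-mid l r)) (¬cross-outside ¬between-right ¬between-left)
    root-chord-nonCrossing .(suc (suc (double L + y'))) (in-right y' h) = subst (λ z → ¬ Cross 0 S (suc (suc (double L + y'))) z) (sym (treeMatch-right l r y'))
       (¬cross-outside (¬between-above z<s (s≤s (s≤s (m≤m+n (double L) y')))) (¬between-above z<s (s≤s (s≤s (m≤m+n (double L) _)))))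
    go : ∀ x y → TreeView L R x → TreeView L R y → ¬ Cross x (treeMatch t x) y (treeMatch t y)
    go .0 y at-root vy c = root-chord-nonCrossing y vy c
    go .S y at-mid vy c = root-chord-nonCrossing y vy (cross-swap (subst (λ z → Cross S z y (treeMatch t y)) (treeMatch-mid l r) c))
    go .(suc x') .(suc (suc (double L + y'))) (in-left x' hx') (in-right y' hy') c =
          ¬cross-outside (¬between-above (s≤s (≤-trans hx' (≤-trans (m≤m+n (double L) y') (n≤1+n _)))) (s≤s (≤-trans (TreeInvolution.bounded Tl x' hx') (≤-trans (m≤m+n (double L) y') (n≤1+n _)))))
                  (¬between-above (s≤s (≤-trans hx' (≤-trans (m≤m+n (double L) _) (n≤1+n _)))) (s≤s (≤-trans (TreeInvolution.bounded Tl x' hx') (≤-trans (m≤m+n (double L) _) (n≤1+n _)))))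
            (subst₂ (λ u v → Cross (suc x') u (suc (suc (double L + y'))) v) (treeMatch-left l r hx') (treeMatch-right l r y') c)
    go .(suc x') .(suc y') (in-left x' hx') (in-left y' hy') c = treeMatch-nonCrossing l x' y' hx' hy' (cross-+⁻ 1 (subst₂ (λ u v → Cross (suc x') u (suc y') v) (treeMatch-left l r hx') (treeMatch-left l r hy') c))
    go .(suc x') .0 (in-left x' hx') at-root c = ¬cross-outside (¬between-below z<s (s≤s z≤n)) (¬between-above (s≤s hx') (s≤s (TreeInvolution.bounded Tl x' hx')))
                   (subst (λ u → Cross (suc x') u 0 S) (treeMatch-left l r hx') c)
    go .(suc x') .S (in-left x' hx') at-mid c = ¬cross-outside (¬between-above (s≤s hx') (s≤s (TreeInvolution.bounded Tl x' hx'))) (¬between-below z<s (s≤s z≤n))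
                   (subst₂ (λ u v → Cross (suc x') u S v) (treeMatch-left l r hx') (treeMatch-mid l r) c)
    go .(suc (suc (double L + x'))) y (in-right x' hx') vy c with chord-side y vy
    ... | inj₂ (y' , refl , my , hy') = treeMatch-nonCrossing r x' y' hx' hy' (cross-+⁻ (suc (suc (double L))) (subst₂ (λ u v → Cross (suc (suc (double L + x'))) u (suc (suc (double L + y'))) v) (treeMatch-right l r x') my c))
    ... | inj₁ (yS , myS) = ¬cross-outside (¬between-below (s≤s (≤-trans yS (s≤s (m≤m+n (double L) x')))) (s≤s (≤-trans yS (s≤s (m≤m+n (double L) _)))))
                                    (¬between-below (s≤s (≤-trans myS (s≤s (m≤m+n (double L) x')))) (s≤s (≤-trans myS (s≤s (m≤m+n (double L) _)))))
                                    (subst (λ u → Cross (suc (suc (double L + x'))) u y (treeMatch t y)) (treeMatch-right l r x') c)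


module TreeGrafting where

  open TreeMatchings
  open import Data.Nat
  open import Data.Nat.Properties
  open import Relation.Binary.PropositionalEquality
  open import Data.Nat.Tactic.RingSolver

  graft : Tree → Tree → Tree
  graft leaf t' = t'
  graft (node l r) t' = node l (graft r t')

  size-graft : ∀ t t' → size (graft t t') ≡ size t + size t'
  size-graft leaf t' = refl
  size-graft (node l r) t' = trans (cong (λ z → suc (size l + z)) (size-graft r t')) (cong suc (sym (+-assoc (size l) (size r) (size t'))))

  treeMatch-graft-low : ∀ t t' x → x < double (size t) → treeMatch (graft t t') x ≡ treeMatch t x
  treeMatch-graft-low leaf t' x ()
  treeMatch-graft-low (node l r) t' x h = go x (treeView (size l) (size r) x (subst (x <_) (double-node (size l) (size r)) h))
    where
    go : ∀ x → TreeView (size l) (size r) x → treeMatch (node l (graft r t')) x ≡ treeMatch (node l r) x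
    go .0 at-root = refl
    go .(suc y) (in-left y q) = trans (treeMatch-left l (graft r t') q) (sym (treeMatch-left l r q))
    go .(suc (double (size l))) at-mid = trans (treeMatch-mid l (graft r t')) (sym (treeMatch-mid l r))
    go .(suc (suc (double (size l) + y))) (in-right y q) = trans (treeMatch-right l (graft r t') y) (trans (cong (λ z → suc (suc (double (size l) + z))) (treeMatch-graft-low r t' y q)) (sym (treeMatch-right l r y)))

  treeMatch-graft-high : ∀ t t' x → treeMatch (graft t t') (double (size t) + x) ≡ double (size t) + treeMatch t' x
  treeMatch-graft-high leaf t' x = refl
  treeMatch-graft-high (node l r) t' x = begin
      treeMatch (node l (graft r t')) (double (size (node l r)) + x)
    ≡⟨ cong (treeMatch (node l (graft r t'))) (e (size l) (size r) x) ⟩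
      treeMatch (node l (graft r t')) (suc (suc (double (size l) + (double (size r) + x))))
    ≡⟨ treeMatch-right l (graft r t') (double (size r) + x) ⟩
      suc (suc (double (size l) + treeMatch (graft r t') (double (size r) + x)))
    ≡⟨ cong (λ z → suc (suc (double (size l) + z))) (treeMatch-graft-high r t' x) ⟩
      suc (suc (double (size l) + (double (size r) + treeMatch t' x)))
    ≡⟨ sym (e (size l) (size r) (treeMatch t' x)) ⟩
      double (size (node l r)) + treeMatch t' x ∎
    where
    open ≡-Reasoning
    e : ∀ a b x → double (suc (a + b)) + x ≡ suc (suc (double a + (double b + x)))
    e = arith
      where
      arith : ∀ a b x → (suc (a + b) + suc (a + b)) + x ≡ suc (suc ((a + a) + ((b + b) + x)))
      arith = solve-∀

  chain : ℕ → Tree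
  chain zero = leaf
  chain (suc m) = node leaf (chain m)

  size-chain : ∀ m → size (chain m) ≡ m
  size-chain zero = refl
  size-chain (suc m) = cong suc (size-chain m)

  double-injective : ∀ a b → double a ≡ double b → a ≡ b
  double-injective zero zero e = refl
  double-injective zero (suc b) ()
  double-injective (suc a) zero ()
  double-injective (suc a) (suc b) e = cong suc (double-injective a b (suc-injective (trans (sym (+-suc a a)) (trans (cong pred e) (+-suc b b)))))

  treeMatch-injective : ∀ t t' → size t ≡ size t' → (∀ x → x < double (size t) → treeMatch t x ≡ treeMatch t' x) → t ≡ t'
  treeMatch-injective leaf leaf e h = refl
  treeMatch-injective leaf (node _ _) () h
  treeMatch-injective (node _ _) leaf () h
  treeMatch-injective (node l r) (node l' r') e h = cong₂ node el er
    where
    L = size l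
    R = size r
    bounded : ∀ {x} → x < suc (suc (double L + double R)) → x < double (size (node l r))
    bounded {x} q = subst (x <_) (sym (double-node L R)) q
    eL : L ≡ size l'
    eL = double-injective _ _ (suc-injective (h 0 (bounded z<s)))
    eR : R ≡ size r'
    eR = +-cancelˡ-≡ L _ _ (trans (suc-injective e) (cong (_+ size r') (sym eL)))
    el : l ≡ l'
    el = treeMatch-injective l l' eL (λ y q → suc-injective (trans (sym (treeMatch-left l r q)) (trans (h (suc y) (bounded (s≤s (≤-trans q (≤-trans (m≤m+n _ (double R)) (n≤1+n _))))))
            (treeMatch-left l' r' (subst (λ z → y < double z) eL q)))))
    er : r ≡ r'
    er = treeMatch-injective r r' eR (λ y q → +-cancelˡ-≡ (double L) _ _ (suc-injective (suc-injective
            (trans (sym (treeMatch-right l r y)) (trans (h (suc (suc (double L + y))) (bounded (s≤s (s≤s (+-monoʳ-< (double L) q)))))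
              (trans (trans (cong (λ z → treeMatch (node l' r') (suc (suc (double z + y)))) eL) (treeMatch-right l' r' y)) (cong (λ z → suc (suc (double z + treeMatch r' y))) (sym eL))))))))


module Catalan where

  open import Defs using (catalan)
  open TreeMatchings
  open import Data.Nat
  open import Data.Nat.Properties
  open import Data.Nat.Combinatorics
  open import Data.Nat.DivMod using (m*n/n≡m)
  open import Data.Fin using (Fin; splitAt; join)
  open import Data.Fin.Properties using (join-splitAt)
  open import Data.Vec using (Vec; []; _∷_)
  open import Data.Vec.Properties using (∷-injectiveʳ)
  open import Data.Sum
  open import Data.Empty
  open import Relation.Nullary
  open import Relation.Binary.PropositionalEquality
  open import Data.Nat.Tactic.RingSolver

  -- #forests r k counts the sequences of r trees with k nodes in total; forests r k lists
  -- them, according to whether the first tree is a leaf or has subtrees l, r'.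
  #forests : ℕ → ℕ → ℕ
  #forests zero zero = 1
  #forests zero (suc k) = 0
  #forests (suc r) zero = #forests r zero
  #forests (suc r) (suc k) = #forests r (suc k) + #forests (suc (suc r)) k

  joinFirstTwo : ∀ {r} → Vec Tree (suc (suc r)) → Vec Tree (suc r)
  joinFirstTwo (l ∷ r' ∷ ts) = node l r' ∷ ts

  forestsStep : ∀ r k → (Fin (#forests r (suc k)) → Vec Tree r) → (Fin (#forests (suc (suc r)) k) → Vec Tree (suc (suc r))) →
          Fin (#forests r (suc k)) ⊎ Fin (#forests (suc (suc r)) k) → Vec Tree (suc r)
  forestsStep r k e1 e2 (inj₁ i) = leaf ∷ e1 i
  forestsStep r k e1 e2 (inj₂ i) = joinFirstTwo (e2 i)

  forests : ∀ r k → Fin (#forests r k) → Vec Tree r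
  forests zero zero _ = []
  forests zero (suc k) ()
  forests (suc r) zero i = leaf ∷ forests r zero i
  forests (suc r) (suc k) i = forestsStep r k (forests r (suc k)) (forests (suc (suc r)) k) (splitAt (#forests r (suc k)) i)

  totalSize : ∀ {r} → Vec Tree r → ℕ
  totalSize [] = 0
  totalSize (t ∷ ts) = size t + totalSize ts

  joinFirstTwo-size : ∀ {r} (v : Vec Tree (suc (suc r))) → totalSize (joinFirstTwo v) ≡ suc (totalSize v)
  joinFirstTwo-size (l ∷ r' ∷ ts) = cong suc (+-assoc (size l) (size r') (totalSize ts))

  forestsStep-size : ∀ r k e1 e2 → (∀ i → totalSize (e1 i) ≡ suc k) → (∀ i → totalSize (e2 i) ≡ k) → ∀ x → totalSize (forestsStep r k e1 e2 x) ≡ suc k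
  forestsStep-size r k e1 e2 h1 h2 (inj₁ j) = h1 j
  forestsStep-size r k e1 e2 h1 h2 (inj₂ j) = trans (joinFirstTwo-size (e2 j)) (cong suc (h2 j))

  forests-size : ∀ r k i → totalSize (forests r k i) ≡ k
  forests-size zero zero i = refl
  forests-size zero (suc k) ()
  forests-size (suc r) zero i = forests-size r zero i
  forests-size (suc r) (suc k) i = forestsStep-size r k (forests r (suc k)) (forests (suc (suc r)) k) (forests-size r (suc k)) (forests-size (suc (suc r)) k) (splitAt (#forests r (suc k)) i)

  joinFirstTwo-injective : ∀ {r} (u v : Vec Tree (suc (suc r))) → joinFirstTwo u ≡ joinFirstTwo v → u ≡ v
  joinFirstTwo-injective (l ∷ r' ∷ ts) (l2 ∷ r2 ∷ ts2) refl = refl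

  leaf∷≢joinFirstTwo : ∀ {r} (u : Vec Tree r) (v : Vec Tree (suc (suc r))) → leaf ∷ u ≢ joinFirstTwo v
  leaf∷≢joinFirstTwo u (l ∷ r' ∷ ts) ()

  forestsStep-injective : ∀ r k e1 e2 → (∀ i j → e1 i ≡ e1 j → i ≡ j) → (∀ i j → e2 i ≡ e2 j → i ≡ j) →
              ∀ x y → forestsStep r k e1 e2 x ≡ forestsStep r k e1 e2 y → x ≡ y
  forestsStep-injective r k e1 e2 h1 h2 (inj₁ x) (inj₁ y) e' = cong inj₁ (h1 x y (∷-injectiveʳ e'))
  forestsStep-injective r k e1 e2 h1 h2 (inj₁ x) (inj₂ y) e' = ⊥-elim (leaf∷≢joinFirstTwo (e1 x) (e2 y) e')
  forestsStep-injective r k e1 e2 h1 h2 (inj₂ x) (inj₁ y) e' = ⊥-elim (leaf∷≢joinFirstTwo (e1 y) (e2 x) (sym e'))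
  forestsStep-injective r k e1 e2 h1 h2 (inj₂ x) (inj₂ y) e' = cong inj₂ (h2 x y (joinFirstTwo-injective _ _ e'))

  forests-injective : ∀ r k i j → forests r k i ≡ forests r k j → i ≡ j
  forests-injective zero zero Fin.zero Fin.zero e = refl
    where import Data.Fin as Fin
  forests-injective zero (suc k) ()
  forests-injective (suc r) zero i j e = forests-injective r zero i j (∷-injectiveʳ e)
  forests-injective (suc r) (suc k) i j e =
    trans (sym (join-splitAt a b i)) (trans (cong (join a b) (forestsStep-injective r k (forests r (suc k)) (forests (suc (suc r)) k) (forests-injective r (suc k)) (forests-injective (suc (suc r)) k) (splitAt a i) (splitAt a j) e)) (join-splitAt a b j))
    where
    a = #forests r (suc k)
    b = #forests (suc (suc r)) k

  #forests-zero : ∀ r → #forests r 0 ≡ 1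
  #forests-zero zero = refl
  #forests-zero (suc r) = #forests-zero r

  ballotN : ℕ → ℕ → ℕ
  ballotN r k = suc (suc (double k + r))

  pascal : ∀ n k → n C k + n C suc k ≡ suc n C suc k
  pascal = nCk+nC[k+1]≡[n+1]C[k+1]

  ballot-one : ∀ k → #forests 2 (suc k) + ballotN 1 k C k ≡ ballotN 1 k C suc k →
               #forests 1 (suc (suc k)) + ballotN 0 (suc k) C suc k ≡ ballotN 0 (suc k) C suc (suc k)
  ballot-one k ih = begin
      #forests 2 (suc k) + ballotN 0 (suc k) C suc k
    ≡⟨ cong (λ z → #forests 2 (suc k) + z C suc k) m≡ ⟩
      #forests 2 (suc k) + suc m C suc k
    ≡⟨ cong (#forests 2 (suc k) +_) (sym (pascal m k)) ⟩
      #forests 2 (suc k) + (m C k + m C suc k)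
    ≡⟨ sym (+-assoc (#forests 2 (suc k)) (m C k) (m C suc k)) ⟩
      (#forests 2 (suc k) + m C k) + m C suc k
    ≡⟨ cong (_+ m C suc k) ih ⟩
      m C suc k + m C suc k
    ≡⟨ cong (m C suc k +_) (sym symmetric) ⟩
      m C suc k + m C suc (suc k)
    ≡⟨ pascal m (suc k) ⟩
      suc m C suc (suc k)
    ≡⟨ cong (λ z → z C suc (suc k)) (sym m≡) ⟩
      ballotN 0 (suc k) C suc (suc k) ∎
    where
    open ≡-Reasoning
    m = ballotN 1 k
    m≡ : ballotN 0 (suc k) ≡ suc m
    m≡ = arith k
      where
      arith : ∀ k → suc (suc ((suc k + suc k) + 0)) ≡ suc (suc (suc ((k + k) + 1)))
      arith = solve-∀
    symmetric : m C suc (suc k) ≡ m C suc k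
    symmetric = trans (nCk≡nC[n∸k] (s≤s (s≤s (≤-trans (m≤n+m k k) (m≤m+n (k + k) 1)))))
                      (cong (m C_) (trans (cong (_∸ suc (suc k)) (arith k)) (m+n∸m≡n (suc (suc k)) (suc k))))
      where
      arith : ∀ k → suc (suc ((k + k) + 1)) ≡ suc (suc k) + suc k
      arith = solve-∀

  ballot-zero : ∀ r → #forests (suc r) 1 + ballotN r 0 C 0 ≡ ballotN r 0 C 1 →
                #forests (suc (suc r)) 1 + ballotN (suc r) 0 C 0 ≡ ballotN (suc r) 0 C 1
  ballot-zero r ih = begin
      (#forests (suc r) 1 + #forests (suc (suc (suc r))) 0) + 1
    ≡⟨ cong (λ z → (#forests (suc r) 1 + z) + 1) (#forests-zero (suc (suc (suc r)))) ⟩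
      (#forests (suc r) 1 + 1) + 1
    ≡⟨ cong (_+ 1) ih ⟩
      ballotN r 0 C 1 + 1
    ≡⟨ +-comm (ballotN r 0 C 1) 1 ⟩
      1 + ballotN r 0 C 1
    ≡⟨ pascal (ballotN r 0) 0 ⟩
      suc (ballotN r 0) C 1 ∎
    where open ≡-Reasoning

  ballot-step : ∀ r k → #forests (suc r) (suc (suc k)) + ballotN r (suc k) C suc k ≡ ballotN r (suc k) C suc (suc k) →
                #forests (suc (suc (suc r))) (suc k) + ballotN (suc (suc r)) k C k ≡ ballotN (suc (suc r)) k C suc k →
                #forests (suc (suc r)) (suc (suc k)) + ballotN (suc r) (suc k) C suc k ≡ ballotN (suc r) (suc k) C suc (suc k)
  ballot-step r k ih₁ ih₂ = begin
      (a + b) + N C suc k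
    ≡⟨ cong (λ z → (a + b) + z C suc k) N≡ ⟩
      (a + b) + suc M C suc k
    ≡⟨ cong ((a + b) +_) (sym (pascal M k)) ⟩
      (a + b) + (M C k + M C suc k)
    ≡⟨ arith a b (M C k) (M C suc k) ⟩
      (a + M C suc k) + (b + M C k)
    ≡⟨ cong₂ _+_ ih₁ (subst (λ z → b + z C k ≡ z C suc k) M≡ ih₂) ⟩
      M C suc (suc k) + M C suc k
    ≡⟨ +-comm (M C suc (suc k)) (M C suc k) ⟩
      M C suc k + M C suc (suc k)
    ≡⟨ pascal M (suc k) ⟩
      suc M C suc (suc k)
    ≡⟨ cong (λ z → z C suc (suc k)) (sym N≡) ⟩
      N C suc (suc k) ∎
    where
    open ≡-Reasoning
    a = #forests (suc r) (suc (suc k))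
    b = #forests (suc (suc (suc r))) (suc k)
    M = ballotN r (suc k)
    N = ballotN (suc r) (suc k)
    arith : ∀ a b x y → (a + b) + (x + y) ≡ (a + y) + (b + x)
    arith = solve-∀
    N≡ : N ≡ suc M
    N≡ = arith′ k r
      where
      arith′ : ∀ k r → suc (suc ((suc k + suc k) + suc r)) ≡ suc (suc (suc ((suc k + suc k) + r)))
      arith′ = solve-∀
    M≡ : ballotN (suc (suc r)) k ≡ M
    M≡ = arith′ k r
      where
      arith′ : ∀ k r → suc (suc ((k + k) + suc (suc r))) ≡ suc (suc ((suc k + suc k) + r))
      arith′ = solve-∀

  -- #forests (r + 1) (k + 1) = C(m, k + 1) - C(m, k) with m = 2k + r + 2 (ballot numbers),
  -- with the subtraction moved to the left.
  ballot : ∀ r k → #forests (suc r) (suc k) + ballotN r k C k ≡ ballotN r k C suc k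
  ballot zero zero = refl
  ballot zero (suc k) = ballot-one k (ballot 1 k)
  ballot (suc r) zero = ballot-zero r (ballot r 0)
  ballot (suc r) (suc k) = ballot-step r k (ballot r (suc k)) (ballot (suc (suc r)) k)

  ∸-suc : ∀ m j → j < m → m ∸ j ≡ suc (m ∸ suc j)
  ∸-suc (suc m) zero h = refl
  ∸-suc (suc m) (suc j) (s≤s h) = ∸-suc m j h

  binomial-absorption : ∀ m j → suc j * (m C suc j) ≡ (m ∸ j) * (m C j)
  binomial-absorption zero j = trans (cong (suc j *_) (k>n⇒nCk≡0 {0} {suc j} z<s)) (trans (*-zeroʳ (suc j)) (sym (cong (_* (0 C j)) (0∸n≡0 j))))
  binomial-absorption (suc m) zero = trans (+-identityʳ _) (trans (nC1≡n (suc m)) (sym (*-identityʳ (suc m))))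
  binomial-absorption (suc m) (suc j) = begin
      suc (suc j) * (suc m C suc (suc j))
    ≡⟨ cong (suc (suc j) *_) (sym (pascal m (suc j))) ⟩
      suc (suc j) * (Z + m C suc (suc j))
    ≡⟨ *-distribˡ-+ (suc (suc j)) Z _ ⟩
      suc (suc j) * Z + suc (suc j) * (m C suc (suc j))
    ≡⟨ cong (suc (suc j) * Z +_) (binomial-absorption m (suc j)) ⟩
      suc (suc j) * Z + (m ∸ suc j) * Z
    ≡⟨ mid ⟩
      suc j * Z + (m ∸ j) * Z
    ≡⟨ cong (_+ (m ∸ j) * Z) (binomial-absorption m j) ⟩
      (m ∸ j) * (m C j) + (m ∸ j) * Z
    ≡⟨ sym (*-distribˡ-+ (m ∸ j) (m C j) Z) ⟩
      (m ∸ j) * (m C j + Z)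
    ≡⟨ cong ((m ∸ j) *_) (pascal m j) ⟩
      (m ∸ j) * (suc m C suc j) ∎
    where
    open ≡-Reasoning
    Z = m C suc j
    mid : suc (suc j) * Z + (m ∸ suc j) * Z ≡ suc j * Z + (m ∸ j) * Z
    mid with j <? m
    ... | yes h = trans (l j (m ∸ suc j) Z) (cong (λ w → suc j * Z + w * Z) (sym (∸-suc m j h)))
      where
      l : ∀ j d Z → suc (suc j) * Z + d * Z ≡ suc j * Z + suc d * Z
      l = solve-∀
    ... | no h = trans (cong (λ w → suc (suc j) * w + (m ∸ suc j) * w) z0) (trans (l (suc (suc j)) (m ∸ suc j)) (sym (trans (cong (λ w → suc j * w + (m ∸ j) * w) z0) (l (suc j) (m ∸ j)))))
      where
      z0 : Z ≡ 0
      z0 = k>n⇒nCk≡0 (s≤s (≮⇒≥ h))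
      l : ∀ a b → a * 0 + b * 0 ≡ 0
      l a b = cong₂ _+_ (*-zeroʳ a) (*-zeroʳ b)

  -- (k + 2) · #forests 1 (k + 1) = C(2k + 2, k + 1): by ballot and absorption,
  -- (k + 2) (F + C(m, k)) = (k + 2) C(m, k + 1) = C(m, k + 1) + (k + 2) C(m, k).
  catalan≡#forests : ∀ k → catalan k ≡ #forests 1 k
  catalan≡#forests zero = refl
  catalan≡#forests (suc k) = trans (cong (_/ suc (suc k)) Y≡F*[k+2]) (m*n/n≡m F (suc (suc k)))
    where
    m = ballotN 0 k
    F = #forests 1 (suc k)
    X = m C k
    Y = m C suc k
    2[k+1]≡m : 2 * suc k ≡ m
    2[k+1]≡m = arith k
      where
      arith : ∀ k → 2 * suc k ≡ suc (suc ((k + k) + 0))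
      arith = solve-∀
    m∸k≡k+2 : m ∸ k ≡ suc (suc k)
    m∸k≡k+2 = trans (cong (_∸ k) (arith k)) (m+n∸m≡n k (suc (suc k)))
      where
      arith : ∀ k → suc (suc ((k + k) + 0)) ≡ k + suc (suc k)
      arith = solve-∀
    absorption : suc k * Y ≡ suc (suc k) * X
    absorption = trans (binomial-absorption m k) (cong (_* X) m∸k≡k+2)
    [k+2]F≡Y : suc (suc k) * F ≡ Y
    [k+2]F≡Y = +-cancelʳ-≡ (suc (suc k) * X) _ _
      (trans (sym (*-distribˡ-+ (suc (suc k)) F X)) (trans (cong (suc (suc k) *_) (ballot 0 k)) (cong (Y +_) absorption)))
    Y≡F*[k+2] : (2 * suc k) C suc k ≡ F * suc (suc k)
    Y≡F*[k+2] = trans (cong (_C suc k) 2[k+1]≡m) (trans (sym [k+2]F≡Y) (*-comm (suc (suc k)) F))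


module SymmetricWitnesses where

  open import Defs
  open PartnerFunction
  open Antipode
  open Tabulation
  open TreeMatchings
  open TreeNonCrossing
  open TreeGrafting
  open import Data.Nat
  open import Data.Nat.Properties
  open import Data.Fin using (Fin; toℕ)
  open import Data.Vec using (lookup)
  open import Data.Vec.Properties using (lookup-map)
  open import Data.Sum hiding (map)
  open import Relation.Binary.PropositionalEquality

  2*≡double-size : ∀ n T → size T ≡ n → 2 * n ≡ double (size T)
  2*≡double-size n T e = trans (cong (n +_) (+-identityʳ n)) (cong double (sym e))

  treeMatch-bounded : ∀ n T → size T ≡ n → ∀ i → i < 2 * n → treeMatch T i < 2 * n
  treeMatch-bounded n T e i h = subst (treeMatch T i <_) (sym (2*≡double-size n T e)) (TreeInvolution.bounded (treeInvolution T) i (subst (i <_) (2*≡double-size n T e) h))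

  treePartner : (n : ℕ) (T : Tree) → size T ≡ n → Partner n
  treePartner n T e = fromFunction n (treeMatch T) (treeMatch-bounded n T e)

  treePartner-partner : ∀ n T e i → i < 2 * n → partner n (treePartner n T e) i ≡ treeMatch T i
  treePartner-partner n T e i h = fromFunction-partner n (treeMatch T) (treeMatch-bounded n T e) i h

  treePartner-lookup : ∀ n T e (x : Fin (2 * n)) → toℕ (lookup (treePartner n T e) x) ≡ treeMatch T (toℕ x)
  treePartner-lookup n T e x = fromFunction-lookup n (treeMatch T) (treeMatch-bounded n T e) x

  treePartner-isNCMatching : ∀ n T e → IsNCMatching n (treePartner n T e)
  treePartner-isNCMatching n T e = fromFunction-isNCMatching n (treeMatch T) (treeMatch-bounded n T e)
    (λ i h → TreeInvolution.fixpointFree (treeInvolution T) i (in-range h)) (λ i h → TreeInvolution.involutive (treeInvolution T) i (in-range h)) (λ i j hi hj → treeMatch-nonCrossing T i j (in-range hi) (in-range hj))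
    where
    in-range : ∀ {i} → i < 2 * n → i < double (size T)
    in-range {i} h = subst (i <_) (2*≡double-size n T e) h

  double-suc : ∀ p → double (suc p) ≡ suc (suc (double p))
  double-suc p = cong suc (+-suc p p)

  chain-even : ∀ m p → p < m → treeMatch (chain m) (double p) ≡ suc (double p)
  chain-odd : ∀ m p → p < m → treeMatch (chain m) (suc (double p)) ≡ double p
  chain-even (suc m) zero h = refl
  chain-even (suc m) (suc p) (s≤s h) = trans (cong (treeMatch (chain (suc m))) (double-suc p))
    (trans (treeMatch-right leaf (chain m) (double p)) (trans (cong (λ z → suc (suc z)) (chain-even m p h)) (cong suc (sym (double-suc p)))))
  chain-odd (suc m) zero h = treeMatch-mid leaf (chain m)
  chain-odd (suc m) (suc p) (s≤s h) = trans (cong (λ z → treeMatch (chain (suc m)) (suc z)) (double-suc p))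
    (trans (treeMatch-right leaf (chain m) (suc (double p))) (trans (cong (λ z → suc (suc z)) (chain-odd m p h)) (sym (double-suc p))))

  -- Grafting a tree t of size k onto itself gives a symmetric matching of 4k points whose
  -- reduction mod 2k is the matching of t.
  module SymmetricWitness (k : ℕ) (t : Tree) (size-t : size t ≡ k) where
    n = k + k
    T = graft t t
    size-T : size T ≡ n
    size-T = trans (size-graft t t) (cong₂ _+_ size-t size-t)
    P = treePartner n T size-T
    double-size-t : double (size t) ≡ n
    double-size-t = cong₂ _+_ size-t size-t
    treeMatch-T-low : ∀ i → i < n → treeMatch T i ≡ treeMatch t i
    treeMatch-T-low i h = treeMatch-graft-low t t i (subst (i <_) (sym double-size-t) h)
    treeMatch-t-bounded : ∀ i → i < n → treeMatch t i < n
    treeMatch-t-bounded i h = subst (treeMatch t i <_) double-size-t (TreeInvolution.bounded (treeInvolution t) i (subst (i <_) (sym double-size-t) h))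
    treeMatch-T-high : ∀ i → treeMatch T (n + i) ≡ n + treeMatch t i
    treeMatch-T-high i = subst (λ z → treeMatch T (z + i) ≡ z + treeMatch t i) double-size-t (treeMatch-graft-high t t i)
    symmetric-low : ∀ i → i < n → partner n P (antipode n i) ≡ antipode n (partner n P i)
    symmetric-low i lo = begin
        partner n P (antipode n i)
      ≡⟨ cong (partner n P) (antipode-low lo) ⟩
        partner n P (i + n)
      ≡⟨ treePartner-partner n T size-T (i + n) (<n⇒+n<2n lo) ⟩
        treeMatch T (i + n)
      ≡⟨ cong (treeMatch T) (+-comm i n) ⟩
        treeMatch T (n + i)
      ≡⟨ treeMatch-T-high i ⟩
        n + treeMatch t i
      ≡⟨ +-comm n (treeMatch t i) ⟩
        treeMatch t i + n
      ≡⟨ sym (antipode-low (treeMatch-t-bounded i lo)) ⟩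
        antipode n (treeMatch t i)
      ≡⟨ cong (antipode n) (sym (trans (treePartner-partner n T size-T i i<2n) (treeMatch-T-low i lo))) ⟩
        antipode n (partner n P i) ∎
      where
      open ≡-Reasoning
      i<2n : i < 2 * n
      i<2n = <-≤-trans lo (m≤m+n n (n + 0))

    symmetricFun : ∀ i → i < 2 * n → partner n P (antipode n i) ≡ antipode n (partner n P i)
    symmetricFun i h with <-≤-connex i n
    ... | inj₁ lo = symmetric-low i lo
    ... | inj₂ hi = begin
        partner n P i'
      ≡⟨ sym (antipode-involutive n (partner n P i') (NCInvolution.bounded F i' (antipode< n i h))) ⟩
        antipode n (antipode n (partner n P i'))
      ≡⟨ cong (antipode n) (sym (symmetric-low i' i'<n)) ⟩
        antipode n (partner n P (antipode n i'))
      ≡⟨ cong (λ z → antipode n (partner n P z)) (antipode-involutive n i h) ⟩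
        antipode n (partner n P i) ∎
      where
      open ≡-Reasoning
      F = ncInvolution n P (treePartner-isNCMatching n T size-T)
      i' = antipode n i
      i'<n : i' < n
      i'<n = subst (_< n) (sym (antipode-high hi)) (<+⇒∸< hi (subst (i <_) (cong (n +_) (+-identityʳ n)) h))

    symmetric : Symmetric n P
    symmetric = SymmetricFun⇒Symmetric n P symmetricFun
    reducedPartners-lookup : ∀ (x : Fin (2 * n)) → toℕ x < n → lookup (reducedPartners n P) x ≡ treeMatch t (toℕ x)
    reducedPartners-lookup x h = trans (lookup-map x _ P) (trans (cong (reduceMod n) (treePartner-lookup n T size-T x)) (trans (cong (reduceMod n) (treeMatch-T-low (toℕ x) h)) (reduceMod-low (treeMatch-t-bounded (toℕ x) h))))


module AsymmetricWitnesses where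

  open PartnerFunction
  open Potential
  open Antipode
  open Tabulation
  open TreeMatchings
  open TreeGrafting
  open SymmetricWitnesses
  open import Data.Nat as N using (ℕ; zero; suc; _<_; _≤_; z≤n; s≤s; z<s; _∸_)
  import Data.Nat.Properties as NP
  open import Data.Integer using (ℤ; +_; -_; _+_; _*_)
  import Data.Integer.Properties as ZP
  import Data.Integer.Tactic.RingSolver as ℤ-Solver
  import Data.Nat.Tactic.RingSolver as ℕ-Solver
  open import Data.Fin using (fromℕ<)
  open import Data.Fin.Properties using (toℕ-fromℕ<)
  open import Relation.Nullary
  open import Relation.Binary.PropositionalEquality

  rangeSum-chain : ∀ (G : ℕ → ℤ) o m → (∀ p → p < m → G (o N.+ double p) ≡ sign o) → (∀ p → p < m → G (suc (o N.+ double p)) ≡ + 0) →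
             rangeSum G o (double m) ≡ (+ m) * sign o
  rangeSum-chain G o zero h1 h2 = refl
  rangeSum-chain G o (suc m) h1 h2 = begin
      rangeSum G o (double (suc m))
    ≡⟨ cong (rangeSum G o) (double-suc m) ⟩
      G o + (G (suc o) + rangeSum G (suc (suc o)) (double m))
    ≡⟨ cong₂ (λ a b → a + (b + rangeSum G (suc (suc o)) (double m))) (trans (cong G (sym (NP.+-identityʳ o))) (h1 0 z<s)) (trans (cong (λ z → G (suc z)) (sym (NP.+-identityʳ o))) (h2 0 z<s)) ⟩
      sign o + (+ 0 + rangeSum G (suc (suc o)) (double m))
    ≡⟨ cong (λ z → sign o + (+ 0 + z)) ih ⟩
      sign o + (+ 0 + (+ m) * sign o)
    ≡⟨ arith (sign o) (+ m) ⟩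
      (+ 1 + + m) * sign o ∎
    where
    open ≡-Reasoning
    s2 : sign (suc (suc o)) ≡ sign o
    s2 = ZP.neg-involutive (sign o)
    pos : ∀ p → suc (suc o) N.+ double p ≡ o N.+ double (suc p)
    pos p = sym (trans (cong (o N.+_) (double-suc p)) (trans (NP.+-suc o _) (cong suc (NP.+-suc o _))))
    ih : rangeSum G (suc (suc o)) (double m) ≡ (+ m) * sign o
    ih = trans (rangeSum-chain G (suc (suc o)) m (λ p h → trans (cong G (pos p)) (trans (h1 (suc p) (s≤s h)) (sym s2)))
                                              (λ p h → trans (cong (λ z → G (suc z)) (pos p)) (h2 (suc p) (s≤s h))))
               (cong ((+ m) *_) s2)
    arith : ∀ s M → s + (+ 0 + M * s) ≡ (+ 1 + M) * s
    arith = ℤ-Solver.solve-∀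

  [1+x]∸x≡1 : ∀ x → suc x ∸ x ≡ 1
  [1+x]∸x≡1 zero = refl
  [1+x]∸x≡1 (suc x) = [1+x]∸x≡1 x

  -- u chords {2i, 2i + 1}, then one chord enclosing j such chords (u + 1 + j = n).
  -- Only the enclosing chord can be long, so Φ = u - j + (1 or 3).
  module AsymmetricWitness (n k u j : ℕ) (n≡k+k : n ≡ k N.+ k) (u+1+j≡n : u N.+ suc j ≡ n) (u1 : 1 ≤ u) (j1 : 1 ≤ j) where
    T = graft (chain u) (node (chain j) leaf)
    size-T : size T ≡ n
    size-T = trans (size-graft (chain u) (node (chain j) leaf)) (trans (cong₂ (λ a b → a N.+ suc (b N.+ 0)) (size-chain u) (size-chain j)) (trans (cong (λ z → u N.+ suc z) (NP.+-identityʳ j)) u+1+j≡n))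
    P = treePartner n T size-T
    double-size-chain-u : double (size (chain u)) ≡ double u
    double-size-chain-u = cong double (size-chain u)
    double-size-chain-j : double (size (chain j)) ≡ double j
    double-size-chain-j = cong double (size-chain j)
    U = double u
    treeMatch-prefix : ∀ x → x < U → treeMatch T x ≡ treeMatch (chain u) x
    treeMatch-prefix x h = treeMatch-graft-low (chain u) (node (chain j) leaf) x (subst (x <_) (sym double-size-chain-u) h)
    treeMatch-suffix : ∀ x → treeMatch T (U N.+ x) ≡ U N.+ treeMatch (node (chain j) leaf) x
    treeMatch-suffix x = subst (λ z → treeMatch T (z N.+ x) ≡ z N.+ treeMatch (node (chain j) leaf) x) double-size-chain-u (treeMatch-graft-high (chain u) (node (chain j) leaf) x)
    enclosing-left : treeMatch (node (chain j) leaf) 0 ≡ suc (double j)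
    enclosing-left = cong suc double-size-chain-j
    enclosing-inside : ∀ y → y < double j → treeMatch (node (chain j) leaf) (suc y) ≡ suc (treeMatch (chain j) y)
    enclosing-inside y h = treeMatch-left (chain j) leaf (subst (y <_) (sym double-size-chain-j) h)
    enclosing-right : treeMatch (node (chain j) leaf) (suc (double j)) ≡ 0
    enclosing-right = subst (λ z → treeMatch (node (chain j) leaf) (suc z) ≡ 0) double-size-chain-j (treeMatch-mid (chain j) leaf)
    2≤n : 2 ≤ n
    2≤n = NP.≤-trans (s≤s (s≤s z≤n)) (subst (3 ≤_) u+1+j≡n (NP.+-mono-≤ u1 (s≤s j1)))
    G : ℕ → ℤ
    G i = chordWeight n i (treeMatch T i)
    2n≡U+2j+2 : 2 N.* n ≡ U N.+ suc (suc (double j))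
    2n≡U+2j+2 = trans (cong (λ z → 2 N.* z) (sym u+1+j≡n)) (arith u j)
      where
      arith : ∀ u j → 2 N.* (u N.+ suc j) ≡ (u N.+ u) N.+ suc (suc (j N.+ j))
      arith = ℕ-Solver.solve-∀
    prefix-sum : rangeSum G 0 U ≡ (+ u) * + 1
    prefix-sum = rangeSum-chain G 0 u h1 h2
      where
      h1 : ∀ p → p < u → G (double p) ≡ sign 0
      h1 p h = trans (cong (chordWeight n (double p)) (trans (treeMatch-prefix (double p) in-range) (chain-even u p h)))
                     (trans (chordWeight-short (NP.n<1+n _) (subst (_< n) (sym ([1+x]∸x≡1 (double p))) 2≤n)) (sign-+even 0 p))
        where
        in-range : double p < U
        in-range = NP.+-mono-< h h
      h2 : ∀ p → p < u → G (suc (double p)) ≡ + 0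
      h2 p h = trans (cong (chordWeight n (suc (double p))) (trans (treeMatch-prefix (suc (double p)) in-range) (chain-odd u p h))) (chordWeight-back (NP.n<1+n _))
        where
        in-range : suc (double p) < U
        in-range = subst (_≤ U) (double-suc p) (NP.+-mono-≤ h h)
    inside-position : ∀ p → suc U N.+ double p ≡ U N.+ suc (double p)
    inside-position p = sym (NP.+-suc U (double p))
    inside-sum : rangeSum G (suc U) (double j) ≡ (+ j) * sign (suc U)
    inside-sum = rangeSum-chain G (suc U) j h1 h2
      where
      h1 : ∀ p → p < j → G (suc U N.+ double p) ≡ sign (suc U)
      h1 p h = trans (cong G (inside-position p)) (trans (cong (chordWeight n (U N.+ suc (double p))) treeMatch-inside)
                 (trans (chordWeight-short (NP.+-monoʳ-< U (NP.n<1+n _)) (subst (_< n) (sym gap≡1) 2≤n)) (trans (cong sign (sym (inside-position p))) (sign-+even (suc U) p))))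
        where
        in-range : double p < double j
        in-range = NP.+-mono-< h h
        treeMatch-inside : treeMatch T (U N.+ suc (double p)) ≡ U N.+ suc (suc (double p))
        treeMatch-inside = trans (treeMatch-suffix (suc (double p))) (cong (U N.+_) (trans (enclosing-inside (double p) in-range) (cong suc (chain-even j p h))))
        gap≡1 : (U N.+ suc (suc (double p))) ∸ (U N.+ suc (double p)) ≡ 1
        gap≡1 = trans (NP.[m+n]∸[m+o]≡n∸o U (suc (suc (double p))) (suc (double p))) ([1+x]∸x≡1 (suc (double p)))
      h2 : ∀ p → p < j → G (suc (suc U N.+ double p)) ≡ + 0
      h2 p h = trans (cong G (cong suc (inside-position p))) (trans (cong G (sym (NP.+-suc U (suc (double p))))) (trans (cong (chordWeight n (U N.+ suc (suc (double p)))) treeMatch-inside) (chordWeight-back (NP.+-monoʳ-< U (NP.n<1+n _)))))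
        where
        in-range : suc (double p) < double j
        in-range = subst (_≤ double j) (double-suc p) (NP.+-mono-≤ h h)
        treeMatch-inside : treeMatch T (U N.+ suc (suc (double p))) ≡ U N.+ suc (double p)
        treeMatch-inside = trans (treeMatch-suffix (suc (suc (double p)))) (cong (U N.+_) (trans (enclosing-inside (suc (double p)) in-range) (cong suc (chain-odd j p h))))
    enclosingWeight = chordWeight n U (U N.+ suc (double j))
    weight-enclosing-left : G U ≡ enclosingWeight
    weight-enclosing-left = cong (chordWeight n U) (trans (cong (treeMatch T) (sym (NP.+-identityʳ U))) (trans (treeMatch-suffix 0) (cong (U N.+_) enclosing-left)))
    weight-enclosing-right : G (suc U N.+ double j) ≡ + 0
    weight-enclosing-right = trans (cong G (inside-position j)) (trans (cong (chordWeight n (U N.+ suc (double j))) (trans (treeMatch-suffix (suc (double j))) (trans (cong (U N.+_) enclosing-right) (NP.+-identityʳ U)))) (chordWeight-back (NP.m<m+n U z<s)))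
    sign-U : sign U ≡ + 1
    sign-U = sign-+even 0 u
    Φ-witness : Φ n P ≡ (+ u) * + 1 + (enclosingWeight + ((+ j) * - (+ 1) + (+ 0 + + 0)))
    Φ-witness = begin
        Φ n P
      ≡⟨ Φ-fromFunction n (treeMatch T) (treeMatch-bounded n T size-T) ⟩
        rangeSum G 0 (2 N.* n)
      ≡⟨ cong (rangeSum G 0) 2n≡U+2j+2 ⟩
        rangeSum G 0 (U N.+ suc (suc (double j)))
      ≡⟨ rangeSum-split G 0 U (suc (suc (double j))) ⟩
        rangeSum G 0 U + (G U + rangeSum G (suc U) (suc (double j)))
      ≡⟨ cong₂ (λ a b → a + (G U + b)) prefix-sum (trans (cong (rangeSum G (suc U)) (NP.+-comm 1 (double j))) (rangeSum-split G (suc U) (double j) 1)) ⟩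
        (+ u) * + 1 + (G U + (rangeSum G (suc U) (double j) + (G (suc U N.+ double j) + + 0)))
      ≡⟨ cong₂ (λ a b → (+ u) * + 1 + (a + b)) weight-enclosing-left (cong₂ (λ a b → a + (b + + 0)) (trans inside-sum (cong ((+ j) *_) (cong -_ sign-U))) weight-enclosing-right) ⟩
        (+ u) * + 1 + (enclosingWeight + ((+ j) * - (+ 1) + (+ 0 + + 0))) ∎
      where open ≡-Reasoning

    Φ-witness-short : suc (double j) < n → Φ n P + + (double j) ≡ + n
    Φ-witness-short h = trans (cong (_+ + (double j)) Φ-witness) (trans (cong (λ w → (+ u) * + 1 + (w + ((+ j) * - (+ 1) + (+ 0 + + 0))) + + (double j)) enclosingWeight≡)
               (trans (arith (+ u) (+ j)) (cong +_ u+1+j≡n)))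
      where
      enclosingWeight≡ : enclosingWeight ≡ + 1
      enclosingWeight≡ = trans (chordWeight-short (NP.m<m+n U z<s) (subst (_< n) (sym (NP.m+n∸m≡n U (suc (double j)))) h)) sign-U
      arith : ∀ U J → U * + 1 + (+ 1 + (J * - (+ 1) + (+ 0 + + 0))) + (J + J) ≡ U + (+ 1 + J)
      arith = ℤ-Solver.solve-∀
    Φ-witness-long : ¬ (suc (double j) < n) → ∀ i' → j ≡ suc (suc i') → Φ n P + + (double (suc i')) ≡ + n
    Φ-witness-long h i' refl = trans (cong (_+ + (double (suc i'))) Φ-witness) (trans (cong (λ w → (+ u) * + 1 + (w + ((+ j) * - (+ 1) + (+ 0 + + 0))) + + (double (suc i'))) enclosingWeight≡)
               (trans (arith (+ u) (+ i')) (cong +_ u+1+j≡n)))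
      where
      enclosingWeight≡ : enclosingWeight ≡ + 3 * + 1
      enclosingWeight≡ = trans (chordWeight-long (NP.m<m+n U z<s) (subst (λ z → ¬ (z < n)) (sym (NP.m+n∸m≡n U (suc (double j)))) h)) (cong (+ 3 *_) sign-U)
      arith : ∀ U I → U * + 1 + (+ 3 * + 1 + ((+ 2 + I) * - (+ 1) + (+ 0 + + 0))) + ((+ 1 + I) + (+ 1 + I)) ≡ U + (+ 1 + (+ 2 + I))
      arith = ℤ-Solver.solve-∀

    E = U N.+ suc (double j)
    U<2n : U < 2 N.* n
    U<2n = subst (U <_) (sym 2n≡U+2j+2) (NP.m<m+n U z<s)
    partner-U : partner n P U ≡ E
    partner-U = trans (treePartner-partner n T size-T U U<2n) (trans (cong (treeMatch T) (sym (NP.+-identityʳ U))) (trans (treeMatch-suffix 0) (cong (U N.+_) enclosing-left)))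
    E≡n+u+j : E ≡ n N.+ (u N.+ j)
    E≡n+u+j = trans (arith u j) (cong (N._+ (u N.+ j)) u+1+j≡n)
      where
      arith : ∀ u j → (u N.+ u) N.+ suc (j N.+ j) ≡ (u N.+ suc j) N.+ (u N.+ j)
      arith = ℕ-Solver.solve-∀
    antipode-E : antipode n E ≡ u N.+ j
    antipode-E = trans (antipode-high (subst (n ≤_) (sym E≡n+u+j) (NP.m≤m+n n _))) (trans (cong (_∸ n) E≡n+u+j) (NP.m+n∸m≡n n (u N.+ j)))
    symmetric-at-U : Symmetric n P → partner n P (antipode n U) ≡ u N.+ j
    symmetric-at-U symP = trans (subst (λ z → partner n P (antipode n z) ≡ antipode n (partner n P z)) (toℕ-fromℕ< U<2n) (symP (fromℕ< U<2n))) (trans (cong (antipode n) partner-U) antipode-E)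

    2≰0 : ¬ (2 ≤ 0)
    2≰0 ()
    2≤U : 2 ≤ U
    2≤U = NP.+-mono-≤ u1 u1

    asymmetric-short : j < k → ¬ Symmetric n P
    asymmetric-short j<k symP = 2≰0 (subst (2 ≤_) 2j≡0 (NP.+-mono-≤ j1 j1))
      where
      k≤u : k ≤ u
      k≤u = NP.+-cancelʳ-≤ k k u (subst (_≤ u N.+ k) (trans u+1+j≡n n≡k+k) (NP.+-monoʳ-≤ u j<k))
      q = u ∸ k
      2q+n≡U : double q N.+ n ≡ U
      2q+n≡U = trans (cong (double q N.+_) n≡k+k) (trans (arith q k) (cong double (NP.m∸n+n≡m k≤u)))
        where
        arith : ∀ q k → (q N.+ q) N.+ (k N.+ k) ≡ (q N.+ k) N.+ (q N.+ k)
        arith = ℕ-Solver.solve-∀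
      n≤U : n ≤ U
      n≤U = subst (_≤ U) (sym n≡k+k) (NP.+-mono-≤ k≤u k≤u)
      antipode-U : antipode n U ≡ double q
      antipode-U = trans (antipode-high n≤U) (trans (cong (_∸ n) (sym 2q+n≡U)) (NP.m+n∸n≡m (double q) n))
      1≤k : 1 ≤ k
      1≤k = NP.≤-trans (s≤s z≤n) j<k
      q<u : q < u
      q<u = NP.∸-monoʳ-< {u} {k} {0} 1≤k k≤u
      2q<U : double q < U
      2q<U = NP.+-mono-< q<u q<u
      partner-antipode-U : partner n P (antipode n U) ≡ suc (double q)
      partner-antipode-U = trans (cong (partner n P) antipode-U) (trans (treePartner-partner n T size-T (double q) (NP.<-trans 2q<U U<2n)) (trans (treeMatch-prefix (double q) 2q<U) (chain-even u q q<u)))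
      2q+1≡u+j : suc (double q) ≡ u N.+ j
      2q+1≡u+j = trans (sym partner-antipode-U) (symmetric-at-U symP)
      u+j+n≡ : (u N.+ j) N.+ n ≡ suc (U N.+ double j)
      u+j+n≡ = trans (cong ((u N.+ j) N.+_) (sym u+1+j≡n)) (arith u j)
        where
        arith : ∀ u j → (u N.+ j) N.+ (u N.+ suc j) ≡ suc ((u N.+ u) N.+ (j N.+ j))
        arith = ℕ-Solver.solve-∀
      1+U≡ : suc U ≡ suc (U N.+ double j)
      1+U≡ = trans (cong suc (sym 2q+n≡U)) (trans (cong (N._+ n) 2q+1≡u+j) u+j+n≡)
      2j≡0 : double j ≡ 0
      2j≡0 = sym (NP.+-cancelˡ-≡ U 0 (double j) (trans (NP.+-identityʳ U) (NP.suc-injective 1+U≡)))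

    asymmetric-long : 1 ≤ k → k ≤ j → ¬ Symmetric n P
    asymmetric-long 1≤k k≤j symP = 2≰0 (subst (2 ≤_) U≡0 2≤U)
      where
      k' = N.pred k
      k≡1+k' : k ≡ suc k'
      k≡1+k' = sym (NP.suc-pred k {{N.>-nonZero 1≤k}})
      y = suc (double k')
      n≡1+y : n ≡ suc y
      n≡1+y = trans n≡k+k (trans (cong (λ z → z N.+ z) k≡1+k') (cong suc (NP.+-suc k' k')))
      u<k : u < k
      u<k = NP.+-cancelʳ-≤ k (suc u) k (subst (_≤ k N.+ k) (NP.+-suc u k) (subst (u N.+ suc k ≤_) (trans u+1+j≡n n≡k+k) (NP.+-monoʳ-≤ u (s≤s k≤j))))
      U<n : U < n
      U<n = subst (U <_) (sym n≡k+k) (NP.+-mono-< u<k u<k)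
      k'<j : k' < j
      k'<j = subst (_≤ j) k≡1+k' k≤j
      y<2j : y < double j
      y<2j = subst (_≤ double j) (double-suc k') (NP.+-mono-≤ k'<j k'<j)
      treeMatch-U+n : treeMatch T (U N.+ n) ≡ U N.+ y
      treeMatch-U+n = trans (treeMatch-suffix n) (cong (U N.+_) (trans (cong (treeMatch (node (chain j) leaf)) n≡1+y) (trans (enclosing-inside y y<2j) (cong suc (chain-odd j k' k'<j)))))
      U+n<2n : U N.+ n < 2 N.* n
      U+n<2n = subst (U N.+ n <_) (cong (n N.+_) (sym (NP.+-identityʳ n))) (NP.+-monoˡ-< n U<n)
      partner-antipode-U : partner n P (antipode n U) ≡ U N.+ y
      partner-antipode-U = trans (cong (partner n P) (antipode-low U<n)) (trans (treePartner-partner n T size-T (U N.+ n) U+n<2n) treeMatch-U+n)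
      u+j≡y : u N.+ j ≡ y
      u+j≡y = NP.suc-injective (trans (sym (NP.+-suc u j)) (trans u+1+j≡n n≡1+y))
      U≡0 : U ≡ 0
      U≡0 = NP.+-cancelʳ-≡ y U 0 (trans (sym partner-antipode-U) (trans (symmetric-at-U symP) u+j≡y))


module Components where

  open import Defs
  open Potential using (Φ)
  open Antipode using (reducedPartners; Symmetric)
  open ComponentInvariant
  open TreeMatchings
  open TreeGrafting
  open Catalan
  open SymmetricWitnesses
  open AsymmetricWitnesses
  open import Data.Nat as N using (ℕ; suc; _<_; _≤_; z≤n; s≤s; _∸_; _<?_)
  import Data.Nat.Properties as NP
  open import Data.Integer using (+_; _+_)
  open import Data.Integer.Properties using (+-0-abelianGroup; +-injective)
  open import Algebra.Properties.AbelianGroup +-0-abelianGroup using (∙-cancelˡ)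
  open import Data.Fin using (Fin; toℕ; fromℕ<; splitAt; join; cast)
  open import Data.Fin.Properties using (toℕ-fromℕ<; join-splitAt; toℕ-cast; toℕ-injective; toℕ<n)
  open import Data.Vec using (Vec; lookup; _∷_; []; head)
  open import Data.Nat.DivMod using (_/_; m*n/n≡m)
  open import Data.Nat.Divisibility using (_∣_; divides)
  open import Data.Nat.Tactic.RingSolver using (solve-∀)
  open import Data.Product using (∃; _,_)
  open import Data.Sum using (_⊎_; inj₁; inj₂)
  open import Data.Sum.Properties using (inj₁-injective; inj₂-injective)
  open import Data.Empty using (⊥-elim)
  open import Relation.Nullary using (¬_; yes; no)
  open import Relation.Binary.PropositionalEquality

  record AsymmetricRep (n m : ℕ) : Set where
    field
      P : Partner n
      isNCMatching : IsNCMatching n P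
      asymmetric : ¬ Symmetric n P
      potential : Φ n P + + (double (suc m)) ≡ + n

  -- The witness with j = m + 1 enclosed chords for j < k, and with j = m + 2 otherwise
  -- (where the enclosing chord is long); in both cases Φ = n - 2 (m + 1).
  asymmetricRep : ∀ k → 2 ≤ k → ∀ m → m < (k N.+ k) ∸ 3 → AsymmetricRep (k N.+ k) m
  asymmetricRep k 2≤k m m<n∸3 with suc m <? k
  ... | yes j<k = record { P = B.P ; isNCMatching = treePartner-isNCMatching n B.T B.size-T
                         ; asymmetric = B.asymmetric-short j<k ; potential = B.Φ-witness-short 2j+1<n }
    where
    n = k N.+ k
    j = suc m
    j+1<n : suc j < n
    j+1<n = NP.≤-<-trans j<k (NP.m<m+n k (NP.≤-trans (s≤s z≤n) 2≤k))
    module B = AsymmetricWitness n k (n ∸ suc j) j refl (NP.m∸n+n≡m (NP.<⇒≤ j+1<n)) (NP.m<n⇒0<n∸m j+1<n) (s≤s z≤n)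
    2j+1<n : suc (double j) < n
    2j+1<n = subst (N._≤ n) (double-suc j) (NP.+-mono-≤ j<k j<k)
  ... | no j≮k = record { P = B.P ; isNCMatching = treePartner-isNCMatching n B.T B.size-T
                        ; asymmetric = B.asymmetric-long (NP.≤-trans (s≤s z≤n) 2≤k) k≤j ; potential = B.Φ-witness-long 2j+1≮n m refl }
    where
    n = k N.+ k
    j = suc (suc m)
    k≤j : k ≤ j
    k≤j = NP.≤-trans (NP.≮⇒≥ j≮k) (NP.n≤1+n _)
    3≤n : 3 ≤ n
    3≤n = NP.≤-trans (s≤s (s≤s (s≤s z≤n))) (NP.+-mono-≤ 2≤k 2≤k)
    j+1<n : suc j < n
    j+1<n = subst (3 N.+ m <_) (NP.m+[n∸m]≡n 3≤n) (NP.+-monoʳ-< 3 m<n∸3)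
    module B = AsymmetricWitness n k (n ∸ suc j) j refl (NP.m∸n+n≡m (NP.<⇒≤ j+1<n)) (NP.m<n⇒0<n∸m j+1<n) (s≤s z≤n)
    2j+1≮n : ¬ (suc (double j) < n)
    2j+1≮n q = NP.<-asym q (s≤s (NP.+-mono-≤ k≤j k≤j))

  record SymmetricRep (k : ℕ) (t : Tree) : Set where
    field
      P : Partner (k N.+ k)
      isNCMatching : IsNCMatching (k N.+ k) P
      symmetric : Symmetric (k N.+ k) P
      reduced-lookup : ∀ (x : Fin (2 N.* (k N.+ k))) → toℕ x < k N.+ k → lookup (reducedPartners (k N.+ k) P) x ≡ treeMatch t (toℕ x)

  symmetricRep : ∀ k t → size t ≡ k → SymmetricRep k t
  symmetricRep k t size-t = record
    { P = S.P ; isNCMatching = treePartner-isNCMatching (k N.+ k) S.T S.size-T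
    ; symmetric = S.symmetric ; reduced-lookup = S.reducedPartners-lookup }
    where module S = SymmetricWitness k t size-t

  trees : ∀ k → Fin (#forests 1 k) → Tree
  trees k i = head (forests 1 k i)

  trees-size : ∀ k i → size (trees k i) ≡ k
  trees-size k i with forests 1 k i | forests-size 1 k i
  ... | t ∷ [] | e = trans (sym (NP.+-identityʳ (size t))) e

  trees-injective : ∀ k i j → trees k i ≡ trees k j → i ≡ j
  trees-injective k i j e = forests-injective 1 k i j (singleton-head (forests 1 k i) (forests 1 k j) e)
    where
    singleton-head : ∀ (u v : Vec Tree 1) → head u ≡ head v → u ≡ v
    singleton-head (a ∷ []) (b ∷ []) refl = refl

  module Representatives (k : ℕ) (2≤k : 2 ≤ k) where
    n = k N.+ k

    symmetricRepᵢ : ∀ i → SymmetricRep k (trees k i)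
    symmetricRepᵢ i = symmetricRep k (trees k i) (trees-size k i)

    asymmetricRepᵢ : ∀ (i : Fin (n ∸ 3)) → AsymmetricRep n (toℕ i)
    asymmetricRepᵢ i = asymmetricRep k 2≤k (toℕ i) (toℕ<n i)

    representative : Fin (#forests 1 k) ⊎ Fin (n ∸ 3) → Partner n
    representative (inj₁ i) = SymmetricRep.P (symmetricRepᵢ i)
    representative (inj₂ i) = AsymmetricRep.P (asymmetricRepᵢ i)

    representative-isNCMatching : ∀ x → IsNCMatching n (representative x)
    representative-isNCMatching (inj₁ i) = SymmetricRep.isNCMatching (symmetricRepᵢ i)
    representative-isNCMatching (inj₂ i) = AsymmetricRep.isNCMatching (asymmetricRepᵢ i)

    invariant-inj₁ : ∀ i → invariant n (representative (inj₁ i)) ≡ inj₁ (reducedPartners n (representative (inj₁ i)))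
    invariant-inj₁ i = invariant-symmetric n _ (SymmetricRep.symmetric (symmetricRepᵢ i))

    invariant-inj₂ : ∀ i → invariant n (representative (inj₂ i)) ≡ inj₂ (Φ n (representative (inj₂ i)))
    invariant-inj₂ i = invariant-asymmetric n _ (AsymmetricRep.asymmetric (asymmetricRepᵢ i))

    -- The reduced partners of the first half of the points recover the tree.
    symmetric-injective : ∀ i j → reducedPartners n (representative (inj₁ i)) ≡ reducedPartners n (representative (inj₁ j)) → i ≡ j
    symmetric-injective i j e = trees-injective k i j (treeMatch-injective (trees k i) (trees k j) (trans (trees-size k i) (sym (trees-size k j))) pointwise)
      where
      pointwise : ∀ y → y < double (size (trees k i)) → treeMatch (trees k i) y ≡ treeMatch (trees k j) y
      pointwise y y<2size = begin
          treeMatch (trees k i) y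
        ≡⟨ cong (treeMatch (trees k i)) (sym (toℕ-fromℕ< y<2n)) ⟩
          treeMatch (trees k i) (toℕ (fromℕ< y<2n))
        ≡⟨ sym (SymmetricRep.reduced-lookup (symmetricRepᵢ i) (fromℕ< y<2n) y'<n) ⟩
          lookup (reducedPartners n (representative (inj₁ i))) (fromℕ< y<2n)
        ≡⟨ cong (λ v → lookup v (fromℕ< y<2n)) e ⟩
          lookup (reducedPartners n (representative (inj₁ j))) (fromℕ< y<2n)
        ≡⟨ SymmetricRep.reduced-lookup (symmetricRepᵢ j) (fromℕ< y<2n) y'<n ⟩
          treeMatch (trees k j) (toℕ (fromℕ< y<2n))
        ≡⟨ cong (treeMatch (trees k j)) (toℕ-fromℕ< y<2n) ⟩
          treeMatch (trees k j) y ∎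
        where
        open ≡-Reasoning
        y<n : y < n
        y<n = subst (y <_) (cong double (trees-size k i)) y<2size
        y<2n : y < 2 N.* n
        y<2n = NP.<-≤-trans y<n (NP.m≤m+n n _)
        y'<n : toℕ (fromℕ< y<2n) < n
        y'<n = subst (_< n) (sym (toℕ-fromℕ< y<2n)) y<n

    asymmetric-injective : ∀ i j → Φ n (representative (inj₂ i)) ≡ Φ n (representative (inj₂ j)) → i ≡ j
    asymmetric-injective i j e = toℕ-injective (NP.suc-injective (double-injective _ _ (+-injective
      (∙-cancelˡ (Φ n (representative (inj₂ i))) _ _
        (trans (AsymmetricRep.potential (asymmetricRepᵢ i))
          (sym (trans (cong (_+ + double (suc (toℕ j))) e) (AsymmetricRep.potential (asymmetricRepᵢ j)))))))))

    invariant-representative-injective : ∀ x y → invariant n (representative x) ≡ invariant n (representative y) → x ≡ y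
    invariant-representative-injective (inj₁ i) (inj₁ j) e =
      cong inj₁ (symmetric-injective i j (inj₁-injective (trans (sym (invariant-inj₁ i)) (trans e (invariant-inj₁ j)))))
    invariant-representative-injective (inj₁ i) (inj₂ j) e with trans (sym (invariant-inj₁ i)) (trans e (invariant-inj₂ j))
    ... | ()
    invariant-representative-injective (inj₂ i) (inj₁ j) e with trans (sym (invariant-inj₂ i)) (trans e (invariant-inj₁ j))
    ... | ()
    invariant-representative-injective (inj₂ i) (inj₂ j) e =
      cong inj₂ (asymmetric-injective i j (inj₂-injective (trans (sym (invariant-inj₂ i)) (trans e (invariant-inj₂ j)))))

  cast-splitAt-injective : ∀ {m} a b (e : m ≡ a N.+ b) i j → splitAt a (cast e i) ≡ splitAt a (cast e j) → i ≡ j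
  cast-splitAt-injective a b e i j h = toℕ-injective (trans (sym (toℕ-cast e i)) (trans (cong toℕ cast-i≡cast-j) (toℕ-cast e j)))
    where
    cast-i≡cast-j : cast e i ≡ cast e j
    cast-i≡cast-j = trans (sym (join-splitAt a b (cast e i))) (trans (cong (join a b) h) (join-splitAt a b (cast e j)))


  even⇒double : ∀ {n} → 2 ∣ n → ∃ λ k → n ≡ k N.+ k
  even⇒double (divides k refl) = k , arith k
    where
    arith : ∀ k → k N.* 2 ≡ k N.+ k
    arith = solve-∀

  4≤k+k⇒2≤k : ∀ {k} → 4 ≤ k N.+ k → 2 ≤ k
  4≤k+k⇒2≤k {k} 4≤k+k with 2 N.≤? k
  ... | yes 2≤k = 2≤k
  ... | no 2≰k = ⊥-elim (4≰2 (NP.≤-trans 4≤k+k (NP.+-mono-≤ k≤1 k≤1)))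
    where
    k≤1 : k ≤ 1
    k≤1 = NP.≤-pred (NP.≰⇒> 2≰k)
    4≰2 : ¬ (4 ≤ 2)
    4≰2 (s≤s (s≤s ()))

  #representatives : ∀ k → 2 ≤ k → catalan ((k N.+ k) / 2) N.+ (k N.+ k) ∸ 3 ≡ #forests 1 k N.+ ((k N.+ k) ∸ 3)
  #representatives k 2≤k = begin
      catalan ((k N.+ k) / 2) N.+ (k N.+ k) ∸ 3
    ≡⟨ cong (λ z → catalan z N.+ (k N.+ k) ∸ 3) half ⟩
      catalan k N.+ (k N.+ k) ∸ 3
    ≡⟨ cong (λ z → z N.+ (k N.+ k) ∸ 3) (catalan≡#forests k) ⟩
      #forests 1 k N.+ (k N.+ k) ∸ 3
    ≡⟨ NP.+-∸-assoc (#forests 1 k) (NP.+-mono-≤ (NP.≤-trans (s≤s z≤n) 2≤k) 2≤k) ⟩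
      #forests 1 k N.+ ((k N.+ k) ∸ 3) ∎
    where
    open ≡-Reasoning
    half : (k N.+ k) / 2 ≡ k
    half = trans (cong (_/ 2) (arith k)) (m*n/n≡m k 2)
      where
      arith : ∀ k → k N.+ k ≡ k N.* 2
      arith = solve-∀


open import Defs
open import Data.Nat using (ℕ; _+_; _∸_; _≤_)
open import Data.Nat.DivMod using (_/_)
open import Data.Nat.Divisibility using (_∣_)
open import Data.Fin using (Fin; splitAt; cast)
open import Data.Product using (_×_; ∃; _,_)
open import Data.Sum using (_⊎_)
open import Relation.Nullary using (¬_)
open import Relation.Binary.PropositionalEquality using (_≡_; _≢_; refl)
open ComponentInvariant using (invariant-injective⇒disconnected)
open Catalan using (#forests)
open Components

corollary15 : (n : ℕ) → 2 ∣ n → 4 ≤ n →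
    ∃ λ (R : Fin (catalan (n / 2) + n ∸ 3) → Partner n) →
    (∀ i → IsNCMatching n (R i)) ×
    (∀ i j → i ≢ j → ¬ Connected n (R i) (R j))
corollary15 n 2∣n 4≤n with even⇒double 2∣n
... | k , refl = R , (λ i → representative-isNCMatching (index i)) ,
                 invariant-injective⇒disconnected (k + k) k refl R
                   (λ i j e → cast-splitAt-injective _ _ #R i j (invariant-representative-injective _ _ e))
  where
  2≤k : 2 ≤ k
  2≤k = 4≤k+k⇒2≤k 4≤n
  open Representatives k 2≤k
  #R : catalan ((k + k) / 2) + (k + k) ∸ 3 ≡ #forests 1 k + ((k + k) ∸ 3)
  #R = #representatives k 2≤k
  index : Fin (catalan ((k + k) / 2) + (k + k) ∸ 3) → Fin (#forests 1 k) ⊎ Fin ((k + k) ∸ 3)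
  index i = splitAt (#forests 1 k) (cast #R i)
  R : Fin (catalan ((k + k) / 2) + (k + k) ∸ 3) → Partner (k + k)
  R i = representative (index i)
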